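{- For every integer $n\ge3$, \[ P^n_0(c,d)=\begin{cases}(c^2-2d)^{n/2}, & n \text{ even},\\ (c^2-2d)^{(n-1)/2}c, & n\text{ odd}.\end{cases} \]
   Context: Polynomials are in non-commuting variables $c,d$. For $n\ge1$ and $0\le j\le n-1$, $P^n_j(c,d)=\sum_{i=j}^{n-1}(-1)^{i-j}\binom{n}{i}\check\Phi^n_i(c,d)$, where the $\check\Phi^n_i$ are defined as follows. Let $\Lambda^n$ be the boundary complex of an $n$-simplex with facets $\sigma_0,\dots,\sigma_n$; for $0\le i\le n-1$ let $\Gamma^n_i$ be the simplicial complex generated by $\sigma_0,\dots,\sigma_i$ and $\Lambda^n_i$ the regular CW complex obtained from $\Gamma^n_i$ by attaching a new $(n-1)$-cell $\tau$ with $\partial\tau=\partial\Gamma^n_i$. Its face poset with $\hat0,\hat1$ adjoined is an Eulerian poset of rank $n+1$; let $\Phi_{\Lambda^n_i}$ be its $cd$-index, i.e. the polynomial with $\Phi(a+b,ab+ba)=\sum_{S\subseteq[n]}h_Su_S$, where $f_T$ counts chains $\hat0<x_1<\dots<\hat1$ with rank set $T$, $h_S=\sum_{T\subseteq S}(-1)^{|S\setminus T|}f_T$ and $u_S=u_1\cdots u_n$ with $u_i=b$ iff $i\in S$, else $a$. Then $\check\Phi^n_0=\Phi_{\Lambda^n_0}$ and $\check\Phi^n_i=\Phi_{\Lambda^n_i}-\Phi_{\Lambda^n_{i-1}}$ for $1\le i\le n-1$. -}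

module Defs where

open import Data.Bool using (Bool; true; false; _∧_; _∨_; not; if_then_else_)
open import Data.Nat using (ℕ; zero; suc; _∸_; _≤ᵇ_; _<ᵇ_; _≡ᵇ_)
open import Data.Nat.Combinatorics using (_C_)
open import Data.Fin using (Fin; toℕ)
open import Data.Vec using (Vec; []; _∷_; lookup)
open import Data.List using (List; []; _∷_; _++_; map; concatMap; allFin; length; foldr; upTo)
open import Data.Product using (_×_; _,_)
open import Data.Integer using (ℤ; +_; _+_; _*_; -_)
open import Relation.Binary.PropositionalEquality using (_≡_)
open import Relation.Nullary.Decidable using (does)
open import Relation.Unary using (Pred)

anyL : {A : Set} → (A → Bool) → List A → Bool
anyL p []       = false
anyL p (x ∷ xs) = p x ∨ anyL p xs

sumℕ : List ℕ → ℕ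
sumℕ = foldr Data.Nat._+_ 0
  where import Data.Nat

filterB : {A : Set} → (A → Bool) → List A → List A
filterB p []       = []
filterB p (x ∷ xs) = if p x then x ∷ filterB p xs else filterB p xs

sumℤ : List ℤ → ℤ
sumℤ = foldr _+_ (+ 0)

sign : ℕ → ℤ
sign zero          = + 1
sign (suc zero)    = - (+ 1)
sign (suc (suc k)) = sign k

allSubsets : (m : ℕ) → List (Vec Bool m)
allSubsets zero    = [] ∷ []
allSubsets (suc m) = map (true ∷_) (allSubsets m) ++ map (false ∷_) (allSubsets m)

card : {m : ℕ} → Vec Bool m → ℕ
card []           = 0
card (true ∷ v)   = suc (card v)
card (false ∷ v)  = card v

subsetᵇ : {m : ℕ} → Vec Bool m → Vec Bool m → Bool
subsetᵇ []          []          = true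
subsetᵇ (true ∷ u)  (y ∷ v)     = y ∧ subsetᵇ u v
subsetᵇ (false ∷ u) (y ∷ v)     = subsetᵇ u v

-- The complex Λ^n_i.
-- Vertex set of the n-simplex: Fin (suc n) = {0,…,n}; the facet σ_k is
-- the set of all vertices except k.  A face F (subset of vertices) lies
-- in σ_k iff k ∉ F.

misses : {n : ℕ} → Vec Bool (suc n) → Fin (suc n) → Bool
misses F k = not (lookup F k)

-- F is a (nonempty) face of Γ^n_i = complex generated by σ_0,…,σ_i
inGammaᵇ : (n i : ℕ) → Vec Bool (suc n) → Bool
inGammaᵇ n i F = (1 ≤ᵇ card F) ∧ anyL (λ k → (toℕ k ≤ᵇ i) ∧ misses F k) (allFin (suc n))

-- F is a face of the boundary ∂Γ^n_i, i.e. of the subcomplex generated by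
-- the ridges of Γ^n_i lying in exactly one facet of Γ^n_i.  Every ridge of
-- the simplex boundary is σ_j ∩ σ_k (j ≠ k) and lies in exactly the two
-- facets σ_j, σ_k; it lies in exactly one facet of Γ^n_i iff (up to order)
-- j ≤ i < k.  So F ∈ ∂Γ^n_i iff F ⊆ σ_j ∩ σ_k for some j ≤ i < k.
inBoundaryᵇ : (n i : ℕ) → Vec Bool (suc n) → Bool
inBoundaryᵇ n i F =
  (1 ≤ᵇ card F) ∧
  anyL (λ j → anyL (λ k → (toℕ j ≤ᵇ i) ∧ (i <ᵇ toℕ k) ∧ misses F j ∧ misses F k)
                   (allFin (suc n)))
       (allFin (suc n))

-- Proper cells (all cells of the regular CW complex Λ^n_i)
data Cell (n : ℕ) : Set where
  face : Vec Bool (suc n) → Cell n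
  tau  : Cell n                      -- the new (n-1)-cell τ

cells : (n i : ℕ) → List (Cell n)
cells n i = tau ∷ map face (filterB (inGammaᵇ n i) (allSubsets (suc n)))

-- rank in the face poset with 0̂ (rank 0) and 1̂ (rank n+1) adjoined:
-- an (d)-dimensional cell has rank d+1
rank : {n : ℕ} → Cell n → ℕ
rank (face F) = card F
rank {n} tau  = n

leqᵇ : (n i : ℕ) → Cell n → Cell n → Bool
leqᵇ n i (face F) (face G) = subsetᵇ F G
leqᵇ n i (face F) tau      = inBoundaryᵇ n i F
leqᵇ n i tau      (face G) = false
leqᵇ n i tau      tau      = true

-- Flag f-vector, flag h-vector of the face poset of Λ^n_i (with 0̂,1̂).
-- A rank set S ⊆ [n] is encoded as a list of Booleans of length n, the
-- j-th entry (j = 1,…,n) saying whether j ∈ S.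

ranks : ℕ → List Bool → List ℕ
ranks k []          = []
ranks k (true ∷ s)  = k ∷ ranks (suc k) s
ranks k (false ∷ s) = ranks (suc k) s

-- number of chains  x < y_1 < … < y_m < 1̂  with rank(y_j) = t_j
-- (given ts = t_1 < … < t_m); x = nothing stands for 0̂.
open import Data.Maybe using (Maybe; just; nothing)

chainsAbove : (n i : ℕ) → Maybe (Cell n) → List ℕ → ℕ
chainsAbove n i x []       = 1
chainsAbove n i x (t ∷ ts) =
  sumℕ (map (λ y → if (rank y ≡ᵇ t) ∧ below x y then chainsAbove n i (just y) ts else 0)
            (cells n i))
  where
  below : Maybe (Cell n) → Cell n → Bool
  below nothing  y = true
  below (just x) y = leqᵇ n i x y

flagF : (n i : ℕ) → List Bool → ℕ
flagF n i T = chainsAbove n i nothing (ranks 1 T)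

subsetsWithCodim : List Bool → List (List Bool × ℕ)
subsetsWithCodim []          = ([] , 0) ∷ []
subsetsWithCodim (false ∷ s) = map (λ { (t , k) → (false ∷ t , k) }) (subsetsWithCodim s)
subsetsWithCodim (true ∷ s)  =
  map (λ { (t , k) → (true ∷ t , k) }) (subsetsWithCodim s) ++
  map (λ { (t , k) → (false ∷ t , suc k) }) (subsetsWithCodim s)

flagH : (n i : ℕ) → List Bool → ℤ
flagH n i S = sumℤ (map (λ { (T , k) → sign k * + (flagF n i T) }) (subsetsWithCodim S))

data AB : Set where
  a b : AB

data CD : Set where
  c d : CD

isB : AB → Bool
isB a = false
isB b = true

eqAB : List AB → List AB → Bool
eqAB []      []      = true
eqAB (a ∷ u) (a ∷ v) = eqAB u v
eqAB (b ∷ u) (b ∷ v) = eqAB u v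
eqAB _       _       = false

eqCD : List CD → List CD → Bool
eqCD []      []      = true
eqCD (c ∷ u) (c ∷ v) = eqCD u v
eqCD (d ∷ u) (d ∷ v) = eqCD u v
eqCD _       _       = false

ABPoly : Set
ABPoly = List (ℤ × List AB)

CDPoly : Set
CDPoly = List (ℤ × List CD)

coeffAB : ABPoly → List AB → ℤ
coeffAB p w = sumℤ (map (λ { (z , u) → if eqAB u w then z else + 0 }) p)

coeffCD : CDPoly → List CD → ℤ
coeffCD p w = sumℤ (map (λ { (z , u) → if eqCD u w then z else + 0 }) p)

_≈cd_ : CDPoly → CDPoly → Set
p ≈cd q = ∀ w → coeffCD p w ≡ coeffCD q w

_+cd_ : CDPoly → CDPoly → CDPoly
p +cd q = p ++ q

scaleCD : ℤ → CDPoly → CDPoly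
scaleCD z p = map (λ { (x , u) → (z * x , u) }) p

_-cd_ : CDPoly → CDPoly → CDPoly
p -cd q = p ++ scaleCD (- (+ 1)) q

_*cd_ : CDPoly → CDPoly → CDPoly
p *cd q = concatMap (λ { (x , u) → map (λ { (y , v) → (x * y , u ++ v) }) q }) p

oneCD : CDPoly
oneCD = (+ 1 , []) ∷ []

powCD : CDPoly → ℕ → CDPoly
powCD p zero    = oneCD
powCD p (suc k) = p *cd powCD p k

cP : CDPoly
cP = (+ 1 , c ∷ []) ∷ []

dP : CDPoly
dP = (+ 1 , d ∷ []) ∷ []

expandWord : List CD → List (List AB)
expandWord []      = [] ∷ []
expandWord (c ∷ v) = concatMap (λ w → (a ∷ w) ∷ (b ∷ w) ∷ []) (expandWord v)
expandWord (d ∷ v) = concatMap (λ w → (a ∷ b ∷ w) ∷ (b ∷ a ∷ w) ∷ []) (expandWord v)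

substCD : CDPoly → ABPoly
substCD p = concatMap (λ { (z , v) → map (λ w → (z , w)) (expandWord v) }) p

-- ab-index and cd-index of the face poset of Λ^n_i (an Eulerian poset of
-- rank n+1):  Ψ = Σ_{S ⊆ [n]} h_S u_S, where u_S = u_1⋯u_n, u_j = b iff j ∈ S.
abIndexCoeff : (n i : ℕ) → List AB → ℤ
abIndexCoeff n i w = if length w ≡ᵇ n then flagH n i (map isB w) else + 0

IsCdIndexΛ : (n i : ℕ) → CDPoly → Set
IsCdIndexΛ n i Φ = ∀ w → coeffAB (substCD Φ) w ≡ abIndexCoeff n i w

-- Φ̌^n_i and P^n_j, given the family Φ i = Φ_{Λ^n_i}

checkΦ : (ℕ → CDPoly) → ℕ → CDPoly
checkΦ Φ zero    = Φ zero
checkΦ Φ (suc i) = Φ (suc i) -cd Φ i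

P : (n j : ℕ) → (ℕ → CDPoly) → CDPoly
P n j Φ = concatMap (λ i → scaleCD (sign (i ∸ j) * + (n C i)) (checkΦ Φ i))
                    (filterB (λ i → j ≤ᵇ i) (upTo n))

module Submission where

-- Under c ↦ a + b, d ↦ ab + ba the polynomial c² - 2d becomes (a - b)², and this substitution is
-- injective on cd-polynomials, so it suffices to compare ab-coefficients. By linearity, the
-- coefficient of an ab-word with rank set S in P^n_0 is ∑_{T ⊆ S} (-1)^|S ∖ T| P₀(f_T), where
-- P₀ g = ∑ᵢ (-1)ⁱ C(n,i) (gᵢ - gᵢ₋₁) and f_T(i) is the flag f-number of Λⁿᵢ. Count each chain from its
-- top element x: if x is a face of Γⁿᵢ, the chain below x is a chain of subsets of x; if x = τ, the
-- next element is a face of ∂Γⁿᵢ. The faces of Γⁿᵢ are the vertex sets missing some vertex ≤ i, those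
-- of ∂Γⁿᵢ also miss a vertex > i, and the resulting alternating sums reduce to
-- ∑ᵢ (-1)ⁱ C(n,i) C(n-i, m-i) = [m = 0]. This gives P₀(f_T) = [T = ∅] + (1 - (-1)ⁿ) [T = {n}], and
-- summing over T ⊆ S yields the coefficients of (a - b)ⁿ, respectively (a - b)ⁿ⁻¹ (a + b).

open import Defs
open import Data.Bool using (Bool; true; false; T; _∧_; _∨_; not; if_then_else_)
open import Data.Bool.Properties using (∧-zeroʳ; ∧-identityʳ; ∧-comm; ∧-conicalʳ; ∨-assoc; ∨-identityʳ)
open import Data.Fin using (Fin; toℕ) renaming (zero to fzero; suc to fsuc)
open import Data.Integer using (ℤ; +_; -[1+_]; _+_; _*_; -_; _-_)
import Data.Integer.Properties as ℤ
open import Data.Integer.Tactic.RingSolver using (solve-∀)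
open import Data.List using (List; []; _∷_; _++_; _∷ʳ_; map; concatMap; upTo; reverse; length; tabulate; allFin)
import Data.List.Properties as List
open import Data.List.Relation.Unary.All using (All; []; _∷_)
import Data.List.Relation.Unary.All as All
open import Data.List.Relation.Unary.All.Properties using (++⁺)
open import Data.Maybe using (Maybe; just; nothing)
open import Data.Nat as ℕ using (ℕ; zero; suc; _≤_; _<_; _∸_; _≤ᵇ_; _<ᵇ_; _≡ᵇ_; z≤n; s≤s)
import Data.Nat.Properties as ℕ
open import Data.Nat.Combinatorics using (_C_; nCk+nC[k+1]≡[n+1]C[k+1]; nCk≡nC[n∸k])
open import Data.Nat.DivMod using (_/_; _%_; m≡m%n+[m/n]*n; m*n/n≡m)
open import Data.Product using (_×_; _,_; proj₁; proj₂)
open import Data.Sum using (_⊎_; inj₁; inj₂)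
open import Data.Vec using (Vec; []; _∷_; lookup)
open import Relation.Binary.PropositionalEquality
open import Relation.Nullary using (contradiction)

open import Algebra.Properties.AbelianGroup ℤ.+-0-abelianGroup using (inverseˡ-unique; inverseʳ-unique)

private
  variable
    A B : Set

∑ : List A → (A → ℤ) → ℤ
∑ xs f = sumℤ (map f xs)

infix 5 ∑
syntax ∑ xs (λ x → e) = ∑[ x ∈ xs ] e

𝟙 : Bool → ℤ
𝟙 true  = + 1
𝟙 false = + 0

∑-cong : (xs : List A) {f g : A → ℤ} → (∀ x → f x ≡ g x) → ∑ xs f ≡ ∑ xs g
∑-cong []       f≡g = refl
∑-cong (x ∷ xs) f≡g = cong₂ _+_ (f≡g x) (∑-cong xs f≡g)

∑-++ : (xs ys : List A) (f : A → ℤ) → ∑ (xs ++ ys) f ≡ ∑ xs f + ∑ ys f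
∑-++ []       ys f = sym (ℤ.+-identityˡ _)
∑-++ (x ∷ xs) ys f = trans (cong (_+_ (f x)) (∑-++ xs ys f)) (sym (ℤ.+-assoc (f x) _ _))

∑-zero : (xs : List A) → ∑[ x ∈ xs ] + 0 ≡ + 0
∑-zero []       = refl
∑-zero (x ∷ xs) = trans (ℤ.+-identityˡ _) (∑-zero xs)

∑-+ : (xs : List A) (f g : A → ℤ) → ∑[ x ∈ xs ] (f x + g x) ≡ ∑ xs f + ∑ xs g
∑-+ []       f g = refl
∑-+ (x ∷ xs) f g = trans (cong (_+_ (f x + g x)) (∑-+ xs f g)) (swap (f x) (g x) (∑ xs f) (∑ xs g))
  where
  swap : ∀ p q r s → (p + q) + (r + s) ≡ (p + r) + (q + s)
  swap = solve-∀

∑-*ˡ : (xs : List A) (k : ℤ) (f : A → ℤ) → ∑[ x ∈ xs ] (k * f x) ≡ k * ∑ xs f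
∑-*ˡ []       k f = sym (ℤ.*-zeroʳ k)
∑-*ˡ (x ∷ xs) k f = trans (cong (_+_ (k * f x)) (∑-*ˡ xs k f)) (sym (ℤ.*-distribˡ-+ k (f x) _))

∑-*ʳ : (xs : List A) (f : A → ℤ) (k : ℤ) → ∑[ x ∈ xs ] (f x * k) ≡ ∑ xs f * k
∑-*ʳ xs f k = begin
  ∑[ x ∈ xs ] (f x * k) ≡⟨ ∑-cong xs (λ x → ℤ.*-comm (f x) k) ⟩
  ∑[ x ∈ xs ] (k * f x) ≡⟨ ∑-*ˡ xs k f ⟩
  k * ∑ xs f            ≡⟨ ℤ.*-comm k _ ⟩
  ∑ xs f * k            ∎
  where open ≡-Reasoning

∑-neg : (xs : List A) (f : A → ℤ) → ∑[ x ∈ xs ] (- f x) ≡ - ∑ xs f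
∑-neg []       f = refl
∑-neg (x ∷ xs) f = trans (cong (_+_ (- f x)) (∑-neg xs f)) (sym (ℤ.neg-distrib-+ (f x) _))

∑-- : (xs : List A) (f g : A → ℤ) → ∑[ x ∈ xs ] (f x - g x) ≡ ∑ xs f - ∑ xs g
∑-- xs f g = trans (∑-+ xs f (λ x → - g x)) (cong (_+_ (∑ xs f)) (∑-neg xs g))

∑-map : (h : A → B) (xs : List A) (f : B → ℤ) → ∑ (map h xs) f ≡ ∑[ x ∈ xs ] f (h x)
∑-map h []       f = refl
∑-map h (x ∷ xs) f = cong (_+_ (f (h x))) (∑-map h xs f)

∑-concatMap : (h : A → List B) (xs : List A) (f : B → ℤ) →
              ∑ (concatMap h xs) f ≡ ∑[ x ∈ xs ] ∑ (h x) f
∑-concatMap h []       f = refl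
∑-concatMap h (x ∷ xs) f =
  trans (∑-++ (h x) (concatMap h xs) f) (cong (_+_ (∑ (h x) f)) (∑-concatMap h xs f))

∑-comm : (xs : List A) (ys : List B) (g : A → B → ℤ) →
         ∑[ x ∈ xs ] ∑[ y ∈ ys ] g x y ≡ ∑[ y ∈ ys ] ∑[ x ∈ xs ] g x y
∑-comm []       ys g = sym (∑-zero ys)
∑-comm (x ∷ xs) ys g =
  trans (cong (_+_ (∑ ys (g x))) (∑-comm xs ys g)) (sym (∑-+ ys (g x) (λ y → ∑[ x ∈ xs ] g x y)))

∑*∑-comm : (xs : List A) (ys : List B) (f : A → ℤ) (g : B → ℤ) (h : A → B → ℤ) →
           ∑[ x ∈ xs ] f x * (∑[ y ∈ ys ] g y * h x y) ≡ ∑[ y ∈ ys ] g y * (∑[ x ∈ xs ] f x * h x y)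
∑*∑-comm xs ys f g h = begin
  ∑[ x ∈ xs ] f x * (∑[ y ∈ ys ] g y * h x y)
    ≡⟨ ∑-cong xs (λ x → trans (sym (∑-*ˡ ys (f x) _)) (∑-cong ys (λ y → swap (f x) (g y) (h x y)))) ⟩
  ∑[ x ∈ xs ] ∑[ y ∈ ys ] g y * (f x * h x y)
    ≡⟨ ∑-comm xs ys (λ x y → g y * (f x * h x y)) ⟩
  ∑[ y ∈ ys ] ∑[ x ∈ xs ] g y * (f x * h x y)
    ≡⟨ ∑-cong ys (λ y → ∑-*ˡ xs (g y) _) ⟩
  ∑[ y ∈ ys ] g y * (∑[ x ∈ xs ] f x * h x y) ∎
  where
  open ≡-Reasoning
  swap : ∀ p q r → p * (q * r) ≡ q * (p * r)
  swap = solve-∀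

∑-filter : (p : A → Bool) (xs : List A) (f : A → ℤ) → ∑ (filterB p xs) f ≡ ∑[ x ∈ xs ] (𝟙 (p x) * f x)
∑-filter p []       f = refl
∑-filter p (x ∷ xs) f with p x
... | true  = cong₂ _+_ (sym (ℤ.*-identityˡ (f x))) (∑-filter p xs f)
... | false = trans (∑-filter p xs f) (sym (ℤ.+-identityˡ _))

𝟙-if : (b : Bool) (v : ℤ) → (if b then v else + 0) ≡ 𝟙 b * v
𝟙-if true  v = sym (ℤ.*-identityˡ v)
𝟙-if false v = refl

𝟙-∧ : (b b′ : Bool) → 𝟙 (b ∧ b′) ≡ 𝟙 b * 𝟙 b′
𝟙-∧ true  b′ = sym (ℤ.*-identityˡ (𝟙 b′))
𝟙-∧ false b′ = refl

+-sumℕ : (xs : List A) (f : A → ℕ) → + sumℕ (map f xs) ≡ ∑[ x ∈ xs ] + f x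
+-sumℕ []       f = refl
+-sumℕ (x ∷ xs) f = trans (ℤ.pos-+ (f x) _) (cong (_+_ (+ f x)) (+-sumℕ xs f))

∑-upTo-∷ʳ : (n : ℕ) (f : ℕ → ℤ) → ∑ (upTo (suc n)) f ≡ ∑ (upTo n) f + f n
∑-upTo-∷ʳ n f = begin
  ∑ (upTo (suc n)) f          ≡⟨ cong (λ l → ∑ l f) (sym (List.upTo-∷ʳ n)) ⟩
  ∑ (upTo n ++ n ∷ []) f      ≡⟨ ∑-++ (upTo n) (n ∷ []) f ⟩
  ∑ (upTo n) f + (f n + + 0)  ≡⟨ cong (_+_ (∑ (upTo n) f)) (ℤ.+-identityʳ (f n)) ⟩
  ∑ (upTo n) f + f n          ∎
  where open ≡-Reasoning

∑-upTo-suc : (n : ℕ) (f : ℕ → ℤ) → ∑ (upTo (suc n)) f ≡ f 0 + (∑[ i ∈ upTo n ] f (suc i))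
∑-upTo-suc n f = cong (_+_ (f 0)) (trans (cong (λ l → ∑ l f) (sym (List.map-upTo suc n))) (∑-map suc (upTo n) f))

∑-upTo-cong : (n : ℕ) {f g : ℕ → ℤ} → (∀ i → i < n → f i ≡ g i) → ∑ (upTo n) f ≡ ∑ (upTo n) g
∑-upTo-cong zero    f≡g = refl
∑-upTo-cong (suc n) {f} {g} f≡g = begin
  ∑ (upTo (suc n)) f  ≡⟨ ∑-upTo-∷ʳ n f ⟩
  ∑ (upTo n) f + f n  ≡⟨ cong₂ _+_ (∑-upTo-cong n (λ i i<n → f≡g i (ℕ.m<n⇒m<1+n i<n))) (f≡g n ℕ.≤-refl) ⟩
  ∑ (upTo n) g + g n  ≡⟨ sym (∑-upTo-∷ʳ n g) ⟩
  ∑ (upTo (suc n)) g  ∎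
  where open ≡-Reasoning

∑-upTo-reverse : (n : ℕ) (f : ℕ → ℤ) → ∑ (upTo n) f ≡ ∑[ i ∈ upTo n ] f (n ∸ suc i)
∑-upTo-reverse zero    f = refl
∑-upTo-reverse (suc n) f = begin
  ∑ (upTo (suc n)) f                          ≡⟨ ∑-upTo-∷ʳ n f ⟩
  ∑ (upTo n) f + f n                          ≡⟨ cong (_+ f n) (∑-upTo-reverse n f) ⟩
  (∑[ i ∈ upTo n ] f (n ∸ suc i)) + f n       ≡⟨ ℤ.+-comm _ (f n) ⟩
  f n + (∑[ i ∈ upTo n ] f (n ∸ suc i))       ≡⟨ sym (∑-upTo-suc n (λ i → f (suc n ∸ suc i))) ⟩
  ∑[ i ∈ upTo (suc n) ] f (suc n ∸ suc i)     ∎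
  where open ≡-Reasoning

≡ᵇ-refl : ∀ n → (n ≡ᵇ n) ≡ true
≡ᵇ-refl zero    = refl
≡ᵇ-refl (suc n) = ≡ᵇ-refl n

≢⇒≡ᵇ≡false : ∀ {m n} → m ≢ n → (m ≡ᵇ n) ≡ false
≢⇒≡ᵇ≡false {m} {n} m≢n with m ≡ᵇ n in m≡ᵇn
... | true  = contradiction (ℕ.≡ᵇ⇒≡ m n (subst T (sym m≡ᵇn) _)) m≢n
... | false = refl

≡ᵇ≡true⇒≡ : ∀ {m n} → (m ≡ᵇ n) ≡ true → m ≡ n
≡ᵇ≡true⇒≡ {m} {n} m≡ᵇn = ℕ.≡ᵇ⇒≡ m n (subst T (sym m≡ᵇn) _)

1≤⇒1≤ᵇ : ∀ {k} → 1 ≤ k → (1 ≤ᵇ k) ≡ true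
1≤⇒1≤ᵇ (s≤s _) = refl

-- Pascal's recursion, which computes; the library's _C_ is defined through factorials
binomial : ℕ → ℕ → ℕ
binomial n       zero    = 1
binomial zero    (suc k) = 0
binomial (suc n) (suc k) = binomial n k ℕ.+ binomial n (suc k)

C≡binomial : ∀ n k → n C k ≡ binomial n k
C≡binomial n       zero    = refl
C≡binomial zero    (suc k) = refl
C≡binomial (suc n) (suc k) =
  trans (sym (nCk+nC[k+1]≡[n+1]C[k+1] n k)) (cong₂ ℕ._+_ (C≡binomial n k) (C≡binomial n (suc k)))

k>n⇒binomial≡0 : ∀ {n k} → n < k → binomial n k ≡ 0
k>n⇒binomial≡0 {zero}  {suc k} _         = refl
k>n⇒binomial≡0 {suc n} {suc k} (s≤s n<k) = cong₂ ℕ._+_ (k>n⇒binomial≡0 n<k) (k>n⇒binomial≡0 (ℕ.m<n⇒m<1+n n<k))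

binomial-diag : ∀ n → binomial n n ≡ 1
binomial-diag zero    = refl
binomial-diag (suc n) = cong₂ ℕ._+_ (binomial-diag n) (k>n⇒binomial≡0 (ℕ.n<1+n n))

binomial-sym : ∀ {n i} → i ≤ n → binomial n (n ∸ i) ≡ binomial n i
binomial-sym {n} {i} i≤n = begin
  binomial n (n ∸ i) ≡⟨ sym (C≡binomial n (n ∸ i)) ⟩
  n C (n ∸ i)        ≡⟨ sym (nCk≡nC[n∸k] i≤n) ⟩
  n C i              ≡⟨ C≡binomial n i ⟩
  binomial n i       ∎
  where open ≡-Reasoning

sign-suc : ∀ k → sign (suc k) ≡ - sign k
sign-suc zero          = refl
sign-suc (suc zero)    = refl
sign-suc (suc (suc k)) = sign-suc k

sign-+ : ∀ p q → sign (p ℕ.+ q) ≡ sign p * sign q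
sign-+ zero          q = sym (ℤ.*-identityˡ (sign q))
sign-+ (suc zero)    q = trans (sign-suc q) (sym (ℤ.-1*i≡-i (sign q)))
sign-+ (suc (suc p)) q = sign-+ p q

sign-*-sign : ∀ k → sign k * sign k ≡ + 1
sign-*-sign zero          = refl
sign-*-sign (suc zero)    = refl
sign-*-sign (suc (suc k)) = sign-*-sign k

sign-∸ : ∀ {n j} → j ≤ n → sign (n ∸ j) ≡ sign n * sign j
sign-∸ {n} {j} j≤n = begin
  sign (n ∸ j)                      ≡⟨ sym (ℤ.*-identityʳ _) ⟩
  sign (n ∸ j) * + 1                ≡⟨ cong (sign (n ∸ j) *_) (sym (sign-*-sign j)) ⟩
  sign (n ∸ j) * (sign j * sign j)  ≡⟨ sym (ℤ.*-assoc (sign (n ∸ j)) (sign j) (sign j)) ⟩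
  sign (n ∸ j) * sign j * sign j    ≡⟨ cong (_* sign j) (sym (sign-+ (n ∸ j) j)) ⟩
  sign (n ∸ j ℕ.+ j) * sign j       ≡⟨ cong (λ k → sign k * sign j) (ℕ.m∸n+n≡m j≤n) ⟩
  sign n * sign j                   ∎
  where open ≡-Reasoning

σC : ℕ → ℕ → ℤ
σC n i = sign i * + binomial n i

previous : (ℕ → ℤ) → ℕ → ℤ
previous g zero    = + 0
previous g (suc i) = g i

σC-pascal : ∀ n i → σC (suc n) i ≡ σC n i - previous (σC n) i
σC-pascal n zero    = refl
σC-pascal n (suc j) = begin
  sign (suc j) * + (binomial n j ℕ.+ binomial n (suc j))
    ≡⟨ cong₂ (λ s b → s * b) (sign-suc j) (ℤ.pos-+ (binomial n j) (binomial n (suc j))) ⟩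
  - sign j * (+ binomial n j + + binomial n (suc j))
    ≡⟨ regroup (sign j) (+ binomial n j) (+ binomial n (suc j)) ⟩
  - sign j * + binomial n (suc j) - sign j * + binomial n j
    ≡⟨ cong (λ s → s * + binomial n (suc j) - σC n j) (sym (sign-suc j)) ⟩
  σC n (suc j) - σC n j ∎
  where
  open ≡-Reasoning
  regroup : ∀ s x y → - s * (x + y) ≡ - s * y - s * x
  regroup = solve-∀

-- C↓ L m i = C(L ∸ i, m ∸ i) when i ≤ m, and 0 when m < i
C↓ : ℕ → ℕ → ℕ → ℕ
C↓ L       m       zero    = binomial L m
C↓ zero    m       (suc i) = 0
C↓ (suc L) zero    (suc i) = 0
C↓ (suc L) (suc m) (suc i) = C↓ L m i

m<i⇒C↓≡0 : ∀ L {m i} → m < i → C↓ L m i ≡ 0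
m<i⇒C↓≡0 zero    {zero}  {suc i} _         = refl
m<i⇒C↓≡0 (suc L) {zero}  {suc i} _         = refl
m<i⇒C↓≡0 zero    {suc m} {suc i} _         = refl
m<i⇒C↓≡0 (suc L) {suc m} {suc i} (s≤s m<i) = m<i⇒C↓≡0 L m<i

C↓-diag : ∀ n → C↓ n n n ≡ 1
C↓-diag zero    = refl
C↓-diag (suc n) = C↓-diag n

C↓-suc-0 : ∀ {L i} → i ≤ L → C↓ (suc L) 0 i ≡ C↓ L 0 i
C↓-suc-0 {L}     {zero}  _ = refl
C↓-suc-0 {suc L} {suc i} _ = refl

C↓-pascal : ∀ {L} m {i} → i ≤ L → C↓ (suc L) (suc m) i ≡ C↓ L (suc m) i ℕ.+ C↓ L m i
C↓-pascal {L}     m       {zero}  _         = ℕ.+-comm (binomial L m) (binomial L (suc m))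
C↓-pascal {suc L} zero    {suc i} (s≤s i≤L) = trans (C↓-suc-0 i≤L) (sym (ℕ.+-identityʳ _))
C↓-pascal {suc L} (suc m) {suc i} (s≤s i≤L) = C↓-pascal m i≤L

-- Pascal's rule for both C(n+1, i) and C↓ reduces the case (n + 1, m + 1) to (n, m + 1).
∑σC*C↓≡[m≡0] : ∀ n m → ∑[ i ∈ upTo (suc n) ] σC n i * + C↓ n m i ≡ 𝟙 (m ≡ᵇ 0)
∑σC*C↓≡[m≡0] zero    zero    = refl
∑σC*C↓≡[m≡0] zero    (suc m) = refl
∑σC*C↓≡[m≡0] (suc n) zero    = begin
  ∑[ i ∈ upTo (suc (suc n)) ] σC (suc n) i * + C↓ (suc n) 0 i
    ≡⟨ ∑-upTo-suc (suc n) (λ i → σC (suc n) i * + C↓ (suc n) 0 i) ⟩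
  + 1 * + 1 + (∑[ j ∈ upTo (suc n) ] σC (suc n) (suc j) * + 0)
    ≡⟨ cong (_+_ (+ 1)) (trans (∑-cong (upTo (suc n)) (λ j → ℤ.*-zeroʳ (σC (suc n) (suc j))))
                               (∑-zero (upTo (suc n)))) ⟩
  + 1 ∎
  where open ≡-Reasoning
∑σC*C↓≡[m≡0] (suc n) (suc m) = begin
  ∑[ i ∈ upTo (suc (suc n)) ] σC (suc n) i * C i
    ≡⟨ ∑-cong (upTo (suc (suc n))) (λ i → trans (cong (_* C i) (σC-pascal n i)) (distribʳ-- (σC n i) _ (C i))) ⟩
  ∑[ i ∈ upTo (suc (suc n)) ] (σC n i * C i - previous (σC n) i * C i)
    ≡⟨ ∑-- (upTo (suc (suc n))) (λ i → σC n i * C i) (λ i → previous (σC n) i * C i) ⟩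
  (∑[ i ∈ upTo (suc (suc n)) ] σC n i * C i) - (∑[ i ∈ upTo (suc (suc n)) ] previous (σC n) i * C i)
    ≡⟨ cong₂ _-_ upper lower ⟩
  (S (suc m) + S m) - S m
    ≡⟨ cancel (S (suc m)) (S m) ⟩
  S (suc m)
    ≡⟨ ∑σC*C↓≡[m≡0] n (suc m) ⟩
  + 0 ∎
  where
  open ≡-Reasoning
  distribʳ-- : ∀ x y z → (x - y) * z ≡ x * z - y * z
  distribʳ-- = solve-∀
  cancel : ∀ x y → x + y - y ≡ x
  cancel = solve-∀
  C : ℕ → ℤ
  C i = + C↓ (suc n) (suc m) i
  S : ℕ → ℤ
  S k = ∑[ i ∈ upTo (suc n) ] σC n i * + C↓ n k i
  pascal : ∀ i → i < suc n → σC n i * C i ≡ σC n i * + C↓ n (suc m) i + σC n i * + C↓ n m i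
  pascal i i<1+n = begin
    σC n i * C i                                      ≡⟨ cong (λ k → σC n i * + k) (C↓-pascal m (ℕ.≤-pred i<1+n)) ⟩
    σC n i * + (C↓ n (suc m) i ℕ.+ C↓ n m i)          ≡⟨ cong (σC n i *_) (ℤ.pos-+ (C↓ n (suc m) i) _) ⟩
    σC n i * (+ C↓ n (suc m) i + + C↓ n m i)          ≡⟨ ℤ.*-distribˡ-+ (σC n i) _ _ ⟩
    σC n i * + C↓ n (suc m) i + σC n i * + C↓ n m i   ∎
  vanishing : σC n (suc n) * C (suc n) ≡ + 0
  vanishing = begin
    sign (suc n) * + binomial n (suc n) * C (suc n)
      ≡⟨ cong (λ b → sign (suc n) * + b * C (suc n)) (k>n⇒binomial≡0 (ℕ.n<1+n n)) ⟩
    sign (suc n) * + 0 * C (suc n)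
      ≡⟨ cong (_* C (suc n)) (ℤ.*-zeroʳ (sign (suc n))) ⟩
    + 0 * C (suc n)
      ≡⟨ ℤ.*-zeroˡ (C (suc n)) ⟩
    + 0 ∎
  upper : (∑[ i ∈ upTo (suc (suc n)) ] σC n i * C i) ≡ S (suc m) + S m
  upper = begin
    (∑[ i ∈ upTo (suc (suc n)) ] σC n i * C i)
      ≡⟨ ∑-upTo-∷ʳ (suc n) (λ i → σC n i * C i) ⟩
    (∑[ i ∈ upTo (suc n) ] σC n i * C i) + σC n (suc n) * C (suc n)
      ≡⟨ cong₂ _+_ (∑-upTo-cong (suc n) pascal) vanishing ⟩
    (∑[ i ∈ upTo (suc n) ] (σC n i * + C↓ n (suc m) i + σC n i * + C↓ n m i)) + + 0
      ≡⟨ trans (ℤ.+-identityʳ _)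
               (∑-+ (upTo (suc n)) (λ i → σC n i * + C↓ n (suc m) i) (λ i → σC n i * + C↓ n m i)) ⟩
    S (suc m) + S m ∎
  lower : (∑[ i ∈ upTo (suc (suc n)) ] previous (σC n) i * C i) ≡ S m
  lower = trans (∑-upTo-suc (suc n) (λ i → previous (σC n) i * C i)) (ℤ.+-identityˡ (S m))

σC-reflect : ∀ {n j} → j ≤ n → σC n (n ∸ j) ≡ sign n * σC n j
σC-reflect {n} {j} j≤n = begin
  sign (n ∸ j) * + binomial n (n ∸ j)   ≡⟨ cong₂ (λ s b → s * + b) (sign-∸ j≤n) (binomial-sym j≤n) ⟩
  sign n * sign j * + binomial n j      ≡⟨ ℤ.*-assoc (sign n) (sign j) _ ⟩
  sign n * σC n j                       ∎
  where open ≡-Reasoning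

∑σC*C↓≡-[m≡n] : ∀ n {m} → 1 ≤ m → m ≤ n →
                ∑[ i ∈ upTo n ] σC n i * + C↓ n m i ≡ - (sign n * 𝟙 (m ≡ᵇ n))
∑σC*C↓≡-[m≡n] n {suc m} _ m≤n = inverseˡ-unique _ _ (begin
  (∑[ i ∈ upTo n ] σC n i * + C↓ n (suc m) i) + sign n * 𝟙 (suc m ≡ᵇ n)
    ≡⟨ cong (_+_ (∑[ i ∈ upTo n ] σC n i * + C↓ n (suc m) i)) (sym (lastTerm (ℕ.m≤n⇒m<n∨m≡n m≤n))) ⟩
  (∑[ i ∈ upTo n ] σC n i * + C↓ n (suc m) i) + σC n n * + C↓ n (suc m) n
    ≡⟨ sym (∑-upTo-∷ʳ n (λ i → σC n i * + C↓ n (suc m) i)) ⟩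
  ∑[ i ∈ upTo (suc n) ] σC n i * + C↓ n (suc m) i
    ≡⟨ ∑σC*C↓≡[m≡0] n (suc m) ⟩
  + 0 ∎)
  where
  open ≡-Reasoning
  lastTerm : suc m < n ⊎ suc m ≡ n → σC n n * + C↓ n (suc m) n ≡ sign n * 𝟙 (suc m ≡ᵇ n)
  lastTerm (inj₁ m<n) rewrite m<i⇒C↓≡0 n m<n | ≢⇒≡ᵇ≡false (ℕ.<⇒≢ m<n) =
    trans (ℤ.*-zeroʳ (σC n n)) (sym (ℤ.*-zeroʳ (sign n)))
  lastTerm (inj₂ refl) rewrite binomial-diag n | C↓-diag n | ≡ᵇ-refl n = ℤ.*-identityʳ (sign n * + 1)

∑σC*C↓-reflected : ∀ n {r} → 1 ≤ r → r < n →
                   ∑[ i ∈ upTo n ] σC n i * + C↓ n r (n ∸ i) ≡ - (sign n * + binomial n r)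
∑σC*C↓-reflected n {suc r} _ r<n = begin
  ∑[ i ∈ upTo n ] σC n i * + C↓ n (suc r) (n ∸ i)
    ≡⟨ ∑-upTo-reverse n (λ i → σC n i * + C↓ n (suc r) (n ∸ i)) ⟩
  ∑[ i ∈ upTo n ] σC n (n ∸ suc i) * + C↓ n (suc r) (n ∸ (n ∸ suc i))
    ≡⟨ ∑-upTo-cong n reflected ⟩
  ∑[ i ∈ upTo n ] sign n * f (suc i)
    ≡⟨ ∑-*ˡ (upTo n) (sign n) (λ i → f (suc i)) ⟩
  sign n * (∑[ i ∈ upTo n ] f (suc i))
    ≡⟨ cong (sign n *_) (inverseʳ-unique (f 0) _ (trans (sym (∑-upTo-suc n f)) (∑σC*C↓≡[m≡0] n (suc r)))) ⟩
  sign n * - f 0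
    ≡⟨ cong (λ x → sign n * - x) f0 ⟩
  sign n * - + binomial n (suc r)
    ≡⟨ sym (ℤ.neg-distribʳ-* (sign n) _) ⟩
  - (sign n * + binomial n (suc r)) ∎
  where
  open ≡-Reasoning
  f : ℕ → ℤ
  f i = σC n i * + C↓ n (suc r) i
  f0 : f 0 ≡ + binomial n (suc r)
  f0 = ℤ.*-identityˡ _
  reflected : ∀ i → i < n → σC n (n ∸ suc i) * + C↓ n (suc r) (n ∸ (n ∸ suc i)) ≡ sign n * f (suc i)
  reflected i i<n = begin
    σC n (n ∸ suc i) * + C↓ n (suc r) (n ∸ (n ∸ suc i))
      ≡⟨ cong₂ (λ s j → s * + C↓ n (suc r) j) (σC-reflect i<n) (ℕ.m∸[m∸n]≡n i<n) ⟩
    sign n * σC n (suc i) * + C↓ n (suc r) (suc i)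
      ≡⟨ ℤ.*-assoc (sign n) _ _ ⟩
    sign n * f (suc i) ∎

-- The ab-expansion of a cd-polynomial

occurrences : List CD → List AB → ℤ
occurrences v w = ∑[ u ∈ expandWord v ] 𝟙 (eqAB u w)

abCoeff : CDPoly → List AB → ℤ
abCoeff p w = ∑[ t ∈ p ] proj₁ t * occurrences (proj₂ t) w

coeffAB-substCD : ∀ p w → coeffAB (substCD p) w ≡ abCoeff p w
coeffAB-substCD p w = begin
  coeffAB (substCD p) w
    ≡⟨ ∑-concatMap (λ { (z , v) → map (z ,_) (expandWord v) }) p _ ⟩
  ∑[ t ∈ p ] ∑[ u ∈ map (proj₁ t ,_) (expandWord (proj₂ t)) ] (if eqAB (proj₂ u) w then proj₁ u else + 0)
    ≡⟨ ∑-cong p (λ { (z , v) → trans (∑-map (z ,_) (expandWord v) _)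
                                     (∑-cong (expandWord v) (λ u → 𝟙-if (eqAB u w) z)) }) ⟩
  ∑[ t ∈ p ] ∑[ u ∈ expandWord (proj₂ t) ] 𝟙 (eqAB u w) * proj₁ t
    ≡⟨ ∑-cong p (λ t → ∑-*ʳ (expandWord (proj₂ t)) (λ u → 𝟙 (eqAB u w)) (proj₁ t)) ⟩
  ∑[ t ∈ p ] occurrences (proj₂ t) w * proj₁ t
    ≡⟨ ∑-cong p (λ t → ℤ.*-comm (occurrences (proj₂ t) w) (proj₁ t)) ⟩
  abCoeff p w ∎
  where open ≡-Reasoning

abCoeff-++ : ∀ p q w → abCoeff (p ++ q) w ≡ abCoeff p w + abCoeff q w
abCoeff-++ p q w = ∑-++ p q _

abCoeff-scale : ∀ k p w → abCoeff (scaleCD k p) w ≡ k * abCoeff p w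
abCoeff-scale k p w = begin
  abCoeff (scaleCD k p) w                             ≡⟨ ∑-map _ p _ ⟩
  ∑[ t ∈ p ] k * proj₁ t * occurrences (proj₂ t) w    ≡⟨ ∑-cong p (λ t → ℤ.*-assoc k (proj₁ t) _) ⟩
  ∑[ t ∈ p ] k * (proj₁ t * occurrences (proj₂ t) w)  ≡⟨ ∑-*ˡ p k _ ⟩
  k * abCoeff p w                                     ∎
  where open ≡-Reasoning

private
  ∑-expand-pairs : (F G : List AB → List AB) (us : List (List AB)) (g : List AB → ℤ) →
                   ∑ (concatMap (λ u → F u ∷ G u ∷ []) us) g ≡ ∑[ u ∈ us ] (g (F u) + g (G u))
  ∑-expand-pairs F G us g =
    trans (∑-concatMap _ us g) (∑-cong us (λ u → cong (_+_ (g (F u))) (ℤ.+-identityʳ (g (G u)))))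

occurrences-c : ∀ v w →
                occurrences (c ∷ v) w ≡ ∑[ u ∈ expandWord v ] (𝟙 (eqAB (a ∷ u) w) + 𝟙 (eqAB (b ∷ u) w))
occurrences-c v w = ∑-expand-pairs (a ∷_) (b ∷_) (expandWord v) _

occurrences-d : ∀ v w →
                occurrences (d ∷ v) w ≡ ∑[ u ∈ expandWord v ] (𝟙 (eqAB (a ∷ b ∷ u) w) + 𝟙 (eqAB (b ∷ a ∷ u) w))
occurrences-d v w = ∑-expand-pairs (λ u → a ∷ b ∷ u) (λ u → b ∷ a ∷ u) (expandWord v) _

flipAB : AB → AB
flipAB a = b
flipAB b = a

occurrences-c∷ : ∀ v x w → occurrences (c ∷ v) (x ∷ w) ≡ occurrences v w
occurrences-c∷ v a w = trans (occurrences-c v (a ∷ w)) (∑-cong (expandWord v) (λ u → ℤ.+-identityʳ _))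
occurrences-c∷ v b w = trans (occurrences-c v (b ∷ w)) (∑-cong (expandWord v) (λ u → ℤ.+-identityˡ _))

occurrences-c[] : ∀ v → occurrences (c ∷ v) [] ≡ + 0
occurrences-c[] v = trans (occurrences-c v []) (∑-zero (expandWord v))

occurrences-d∷flip : ∀ v x w → occurrences (d ∷ v) (x ∷ flipAB x ∷ w) ≡ occurrences v w
occurrences-d∷flip v a w = trans (occurrences-d v (a ∷ b ∷ w)) (∑-cong (expandWord v) (λ u → ℤ.+-identityʳ _))
occurrences-d∷flip v b w = trans (occurrences-d v (b ∷ a ∷ w)) (∑-cong (expandWord v) (λ u → ℤ.+-identityˡ _))

occurrences-d∷same : ∀ v x w → occurrences (d ∷ v) (x ∷ x ∷ w) ≡ + 0
occurrences-d∷same v a w = trans (occurrences-d v (a ∷ a ∷ w)) (∑-zero (expandWord v))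
occurrences-d∷same v b w = trans (occurrences-d v (b ∷ b ∷ w)) (∑-zero (expandWord v))

occurrences-d[] : ∀ v → occurrences (d ∷ v) [] ≡ + 0
occurrences-d[] v = trans (occurrences-d v []) (∑-zero (expandWord v))

occurrences-d[x] : ∀ v x → occurrences (d ∷ v) (x ∷ []) ≡ + 0
occurrences-d[x] v a = trans (occurrences-d v (a ∷ [])) (∑-zero (expandWord v))
occurrences-d[x] v b = trans (occurrences-d v (b ∷ [])) (∑-zero (expandWord v))

strip : CD → ℤ × List CD → CDPoly
strip c (z , c ∷ v) = (z , v) ∷ []
strip d (z , d ∷ v) = (z , v) ∷ []
strip _ _           = []

∂ : CD → CDPoly → CDPoly
∂ x p = concatMap (strip x) p

coeffCD-∷ : ∀ x p w → coeffCD p (x ∷ w) ≡ coeffCD (∂ x p) w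
coeffCD-∷ x p w = trans (∑-cong p (stripTerm x)) (sym (∑-concatMap (strip x) p _))
  where
  coeffᵗ : List CD → ℤ × List CD → ℤ
  coeffᵗ w (z , u) = if eqCD u w then z else + 0
  stripTerm : ∀ x t → coeffᵗ (x ∷ w) t ≡ ∑ (strip x t) (coeffᵗ w)
  stripTerm c (z , [])    = refl
  stripTerm c (z , c ∷ v) = sym (ℤ.+-identityʳ _)
  stripTerm c (z , d ∷ v) = refl
  stripTerm d (z , [])    = refl
  stripTerm d (z , c ∷ v) = refl
  stripTerm d (z , d ∷ v) = sym (ℤ.+-identityʳ _)

coeffCD-[] : ∀ p → coeffCD p [] ≡ abCoeff p []
coeffCD-[] p =
  ∑-cong p λ { (z , v) → trans (𝟙-if (eqCD v []) z) (trans (ℤ.*-comm _ z) (cong (z *_) (emptyTerm v))) }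
  where
  emptyTerm : ∀ v → 𝟙 (eqCD v []) ≡ occurrences v []
  emptyTerm []      = refl
  emptyTerm (c ∷ v) = sym (occurrences-c[] v)
  emptyTerm (d ∷ v) = sym (occurrences-d[] v)

after : AB → (List AB → ℤ) → List AB → ℤ
after x f []      = + 0
after x f (y ∷ u) = 𝟙 (eqAB (x ∷ []) (y ∷ [])) * f u

after-∑ : ∀ x (xs : List A) (f : A → List AB → ℤ) u →
          after x (λ w → ∑[ t ∈ xs ] f t w) u ≡ ∑[ t ∈ xs ] after x (f t) u
after-∑ x xs f []      = sym (∑-zero xs)
after-∑ x xs f (y ∷ u) = sym (∑-*ˡ xs (𝟙 (eqAB (x ∷ []) (y ∷ []))) (λ t → f t u))

after-zero : ∀ x {f} → (∀ u → f u ≡ + 0) → ∀ u → after x f u ≡ + 0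
after-zero x f≡0 []      = refl
after-zero x f≡0 (y ∷ u) =
  trans (cong (𝟙 (eqAB (x ∷ []) (y ∷ [])) *_) (f≡0 u)) (ℤ.*-zeroʳ (𝟙 (eqAB (x ∷ []) (y ∷ []))))

-- The first letter of an ab-word comes from a leading c, or from a leading d together with the next letter.
abCoeff-∷ : ∀ p x u → abCoeff p (x ∷ u) ≡ abCoeff (∂ c p) u + after (flipAB x) (abCoeff (∂ d p)) u
abCoeff-∷ p x u = begin
  abCoeff p (x ∷ u)
    ≡⟨ ∑-cong p (λ t → termStep t x u) ⟩
  ∑[ t ∈ p ] (abCoeff (strip c t) u + after (flipAB x) (abCoeff (strip d t)) u)
    ≡⟨ ∑-+ p (λ t → abCoeff (strip c t) u) (λ t → after (flipAB x) (abCoeff (strip d t)) u) ⟩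
  (∑[ t ∈ p ] abCoeff (strip c t) u) + (∑[ t ∈ p ] after (flipAB x) (abCoeff (strip d t)) u)
    ≡⟨ cong₂ _+_ (sym (∑-concatMap (strip c) p (λ t → proj₁ t * occurrences (proj₂ t) u)))
                 (sym (after-∑ (flipAB x) p (λ t → abCoeff (strip d t)) u)) ⟩
  abCoeff (∂ c p) u + after (flipAB x) (λ w → ∑[ t ∈ p ] abCoeff (strip d t) w) u
    ≡⟨ cong (_+_ (abCoeff (∂ c p) u)) (sym (afterCong (flipAB x) u)) ⟩
  abCoeff (∂ c p) u + after (flipAB x) (abCoeff (∂ d p)) u ∎
  where
  open ≡-Reasoning
  afterCong : ∀ y u → after y (abCoeff (∂ d p)) u ≡ after y (λ w → ∑[ t ∈ p ] abCoeff (strip d t) w) u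
  afterCong y []      = refl
  afterCong y (z ∷ u) =
    cong (𝟙 (eqAB (y ∷ []) (z ∷ [])) *_) (∑-concatMap (strip d) p (λ t → proj₁ t * occurrences (proj₂ t) u))
  padding : ∀ x → x ≡ + 0 + + 1 * (x + + 0)
  padding = solve-∀
  termStep : ∀ t x u →
             proj₁ t * occurrences (proj₂ t) (x ∷ u) ≡ abCoeff (strip c t) u + after (flipAB x) (abCoeff (strip d t)) u
  termStep (z , [])    x []      = ℤ.*-zeroʳ z
  termStep (z , [])    x (y ∷ u) =
    trans (ℤ.*-zeroʳ z) (sym (trans (ℤ.+-identityˡ _) (after-zero (flipAB x) (λ _ → refl) (y ∷ u))))
  termStep (z , c ∷ v) x u       = begin
    z * occurrences (c ∷ v) (x ∷ u)
      ≡⟨ cong (z *_) (occurrences-c∷ v x u) ⟩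
    z * occurrences v u
      ≡⟨ sym (trans (ℤ.+-identityʳ _) (ℤ.+-identityʳ _)) ⟩
    z * occurrences v u + + 0 + + 0
      ≡⟨ cong (_+_ (z * occurrences v u + + 0)) (sym (after-zero (flipAB x) (λ _ → refl) u)) ⟩
    z * occurrences v u + + 0 + after (flipAB x) (λ _ → + 0) u ∎
  termStep (z , d ∷ v) x []      = trans (cong (z *_) (occurrences-d[x] v x)) (ℤ.*-zeroʳ z)
  termStep (z , d ∷ v) a (a ∷ u) = trans (cong (z *_) (occurrences-d∷same v a u)) (ℤ.*-zeroʳ z)
  termStep (z , d ∷ v) b (b ∷ u) = trans (cong (z *_) (occurrences-d∷same v b u)) (ℤ.*-zeroʳ z)
  termStep (z , d ∷ v) a (b ∷ u) = trans (cong (z *_) (occurrences-d∷flip v a u)) (padding (z * occurrences v u))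
  termStep (z , d ∷ v) b (a ∷ u) = trans (cong (z *_) (occurrences-d∷flip v b u)) (padding (z * occurrences v u))

-- The coefficients of abu and bbu in the expansion differ by the coefficient of u in that of ∂ d p.
∂d-vanishes : ∀ p → (∀ u → abCoeff p u ≡ + 0) → ∀ u → abCoeff (∂ d p) u ≡ + 0
∂d-vanishes p p≡0 u = begin
  abCoeff (∂ d p) u
    ≡⟨ difference (abCoeff (∂ c p) (b ∷ u)) (abCoeff (∂ d p) u) ⟩
  (abCoeff (∂ c p) (b ∷ u) + + 1 * abCoeff (∂ d p) u) - (abCoeff (∂ c p) (b ∷ u) + + 0 * abCoeff (∂ d p) u)
    ≡⟨ cong₂ _-_ (sym (abCoeff-∷ p a (b ∷ u))) (sym (abCoeff-∷ p b (b ∷ u))) ⟩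
  abCoeff p (a ∷ b ∷ u) - abCoeff p (b ∷ b ∷ u)
    ≡⟨ cong₂ _-_ (p≡0 (a ∷ b ∷ u)) (p≡0 (b ∷ b ∷ u)) ⟩
  + 0 ∎
  where
  open ≡-Reasoning
  difference : ∀ x y → y ≡ (x + + 1 * y) - (x + + 0 * y)
  difference = solve-∀

∂-vanishes : ∀ x p → (∀ u → abCoeff p u ≡ + 0) → ∀ u → abCoeff (∂ x p) u ≡ + 0
∂-vanishes d p p≡0 u = ∂d-vanishes p p≡0 u
∂-vanishes c p p≡0 u = begin
  abCoeff (∂ c p) u
    ≡⟨ sym (ℤ.+-identityʳ _) ⟩
  abCoeff (∂ c p) u + + 0
    ≡⟨ cong (_+_ (abCoeff (∂ c p) u)) (sym (after-zero b (∂d-vanishes p p≡0) u)) ⟩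
  abCoeff (∂ c p) u + after b (abCoeff (∂ d p)) u
    ≡⟨ sym (abCoeff-∷ p a u) ⟩
  abCoeff p (a ∷ u)
    ≡⟨ p≡0 (a ∷ u) ⟩
  + 0 ∎
  where open ≡-Reasoning

abCoeff≡0⇒coeffCD≡0 : ∀ w p → (∀ u → abCoeff p u ≡ + 0) → coeffCD p w ≡ + 0
abCoeff≡0⇒coeffCD≡0 []      p p≡0 = trans (coeffCD-[] p) (p≡0 [])
abCoeff≡0⇒coeffCD≡0 (x ∷ w) p p≡0 =
  trans (coeffCD-∷ x p w) (abCoeff≡0⇒coeffCD≡0 w (∂ x p) (∂-vanishes x p p≡0))

coeffCD-scale : ∀ k p w → coeffCD (scaleCD k p) w ≡ k * coeffCD p w
coeffCD-scale k p w =
  trans (∑-map _ p _) (trans (∑-cong p (λ { (z , v) → scaleTerm (eqCD v w) z })) (∑-*ˡ p k _))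
  where
  scaleTerm : ∀ e z → (if e then k * z else + 0) ≡ k * (if e then z else + 0)
  scaleTerm true  z = refl
  scaleTerm false z = sym (ℤ.*-zeroʳ k)

abCoeff-injective : ∀ p q → (∀ u → abCoeff p u ≡ abCoeff q u) → p ≈cd q
abCoeff-injective p q p≡q w = ℤ.i-j≡0⇒i≡j _ _ (begin
  coeffCD p w - coeffCD q w                     ≡⟨ cong (_+_ (coeffCD p w)) (sym (ℤ.-1*i≡-i (coeffCD q w))) ⟩
  coeffCD p w + -[1+ 0 ] * coeffCD q w          ≡⟨ cong (_+_ (coeffCD p w)) (sym (coeffCD-scale -[1+ 0 ] q w)) ⟩
  coeffCD p w + coeffCD (scaleCD -[1+ 0 ] q) w  ≡⟨ sym (∑-++ p (scaleCD -[1+ 0 ] q) _) ⟩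
  coeffCD (p -cd q) w                           ≡⟨ abCoeff≡0⇒coeffCD≡0 w (p -cd q) difference≡0 ⟩
  + 0                                           ∎)
  where
  open ≡-Reasoning
  difference≡0 : ∀ u → abCoeff (p -cd q) u ≡ + 0
  difference≡0 u = begin
    abCoeff (p -cd q) u                           ≡⟨ abCoeff-++ p (scaleCD -[1+ 0 ] q) u ⟩
    abCoeff p u + abCoeff (scaleCD -[1+ 0 ] q) u  ≡⟨ cong (_+_ (abCoeff p u)) (abCoeff-scale -[1+ 0 ] q u) ⟩
    abCoeff p u + -[1+ 0 ] * abCoeff q u          ≡⟨ cong (λ x → abCoeff p u + -[1+ 0 ] * x) (sym (p≡q u)) ⟩
    abCoeff p u + -[1+ 0 ] * abCoeff p u          ≡⟨ cong (_+_ (abCoeff p u)) (ℤ.-1*i≡-i (abCoeff p u)) ⟩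
    abCoeff p u - abCoeff p u                     ≡⟨ ℤ.+-inverseʳ (abCoeff p u) ⟩
    + 0                                           ∎

-- The ab-expansion of (c² - 2d)^k, which is (a - b)^(2k)

X : CDPoly
X = (cP *cd cP) -cd scaleCD (+ 2) dP

letterSign : AB → ℤ
letterSign a = + 1
letterSign b = -[1+ 0 ]

-- the coefficient of w in (a - b)^|w|
wordSign : List AB → ℤ
wordSign []      = + 1
wordSign (x ∷ w) = letterSign x * wordSign w

-- the coefficient of w in (a - b)^(|w| - 1) (a + b)
wordSignInit : List AB → ℤ
wordSignInit []          = + 1
wordSignInit (x ∷ [])    = + 1
wordSignInit (x ∷ y ∷ w) = letterSign x * wordSignInit (y ∷ w)

∑-X* : ∀ q (f : ℤ × List CD → ℤ) →
       ∑ (X *cd q) f ≡ ∑[ t ∈ q ] (f (+ 1 * proj₁ t , c ∷ c ∷ proj₂ t) + f (-[1+ 1 ] * proj₁ t , d ∷ proj₂ t))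
∑-X* q f = begin
  ∑ (X *cd q) f
    ≡⟨ ∑-++ (map _ q) _ f ⟩
  ∑ (map _ q) f + ∑ (map _ q ++ []) f
    ≡⟨ cong₂ _+_ (∑-map _ q f) (trans (∑-++ (map _ q) [] f) (trans (ℤ.+-identityʳ _) (∑-map _ q f))) ⟩
  (∑[ t ∈ q ] f (+ 1 * proj₁ t , c ∷ c ∷ proj₂ t)) + (∑[ t ∈ q ] f (-[1+ 1 ] * proj₁ t , d ∷ proj₂ t))
    ≡⟨ sym (∑-+ q _ _) ⟩
  ∑[ t ∈ q ] (f (+ 1 * proj₁ t , c ∷ c ∷ proj₂ t) + f (-[1+ 1 ] * proj₁ t , d ∷ proj₂ t)) ∎
  where open ≡-Reasoning

Xoccurrences : List CD → List AB → ℤ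
Xoccurrences v w = occurrences (c ∷ c ∷ v) w - + 2 * occurrences (d ∷ v) w

abCoeff-X* : ∀ q w → abCoeff (X *cd q) w ≡ ∑[ t ∈ q ] proj₁ t * Xoccurrences (proj₂ t) w
abCoeff-X* q w = trans (∑-X* q (λ t → proj₁ t * occurrences (proj₂ t) w))
                       (∑-cong q (λ t → collect (proj₁ t) (occurrences (c ∷ c ∷ proj₂ t) w)
                                                           (occurrences (d ∷ proj₂ t) w)))
  where
  collect : ∀ z m n → + 1 * z * m + -[1+ 1 ] * z * n ≡ z * (m - + 2 * n)
  collect = solve-∀

Xoccurrences-∷∷ : ∀ v x y u → Xoccurrences v (x ∷ y ∷ u) ≡ letterSign x * letterSign y * occurrences v u
Xoccurrences-∷∷ v x y u = begin
  occurrences (c ∷ c ∷ v) (x ∷ y ∷ u) - + 2 * occurrences (d ∷ v) (x ∷ y ∷ u)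
    ≡⟨ cong (_- + 2 * occurrences (d ∷ v) (x ∷ y ∷ u))
            (trans (occurrences-c∷ (c ∷ v) x (y ∷ u)) (occurrences-c∷ v y u)) ⟩
  occurrences v u - + 2 * occurrences (d ∷ v) (x ∷ y ∷ u)
    ≡⟨ dPart x y ⟩
  letterSign x * letterSign y * occurrences v u ∎
  where
  open ≡-Reasoning
  m : ℤ
  m = occurrences v u
  same : ∀ s → s * s ≡ + 1 → m - + 2 * + 0 ≡ s * s * m
  same s s²≡1 = trans (ℤ.+-identityʳ m) (sym (trans (cong (_* m) s²≡1) (ℤ.*-identityˡ m)))
  opposite′ : ∀ m → m - + 2 * m ≡ -[1+ 0 ] * m
  opposite′ = solve-∀
  opposite : ∀ s → s * - s ≡ -[1+ 0 ] → m - + 2 * m ≡ s * - s * m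
  opposite s s*-s≡-1 = trans (opposite′ m) (cong (_* m) (sym s*-s≡-1))
  dPart : ∀ x y → m - + 2 * occurrences (d ∷ v) (x ∷ y ∷ u) ≡ letterSign x * letterSign y * m
  dPart a a = trans (cong (λ n → m - + 2 * n) (occurrences-d∷same v a u)) (same (+ 1) refl)
  dPart b b = trans (cong (λ n → m - + 2 * n) (occurrences-d∷same v b u)) (same -[1+ 0 ] refl)
  dPart a b = trans (cong (λ n → m - + 2 * n) (occurrences-d∷flip v a u)) (opposite (+ 1) refl)
  dPart b a = trans (cong (λ n → m - + 2 * n) (occurrences-d∷flip v b u)) (opposite -[1+ 0 ] refl)

Xoccurrences-[] : ∀ v → Xoccurrences v [] ≡ + 0
Xoccurrences-[] v rewrite occurrences-c[] (c ∷ v) | occurrences-d[] v = refl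

Xoccurrences-[x] : ∀ v x → Xoccurrences v (x ∷ []) ≡ + 0
Xoccurrences-[x] v x rewrite occurrences-c∷ (c ∷ v) x [] | occurrences-c[] v | occurrences-d[x] v x = refl

abCoeff-X*-∷∷ : ∀ q x y u → abCoeff (X *cd q) (x ∷ y ∷ u) ≡ letterSign x * letterSign y * abCoeff q u
abCoeff-X*-∷∷ q x y u = begin
  abCoeff (X *cd q) (x ∷ y ∷ u)
    ≡⟨ abCoeff-X* q (x ∷ y ∷ u) ⟩
  ∑[ t ∈ q ] proj₁ t * Xoccurrences (proj₂ t) (x ∷ y ∷ u)
    ≡⟨ ∑-cong q (λ t → trans (cong (proj₁ t *_) (Xoccurrences-∷∷ (proj₂ t) x y u)) (swap (proj₁ t) s _)) ⟩
  ∑[ t ∈ q ] s * (proj₁ t * occurrences (proj₂ t) u)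
    ≡⟨ ∑-*ˡ q s _ ⟩
  s * abCoeff q u ∎
  where
  open ≡-Reasoning
  s : ℤ
  s = letterSign x * letterSign y
  swap : ∀ z s m → z * (s * m) ≡ s * (z * m)
  swap = solve-∀

abCoeff-X*-short : ∀ q w → length w < 2 → abCoeff (X *cd q) w ≡ + 0
abCoeff-X*-short q w |w|<2 = begin
  abCoeff (X *cd q) w
    ≡⟨ abCoeff-X* q w ⟩
  ∑[ t ∈ q ] proj₁ t * Xoccurrences (proj₂ t) w
    ≡⟨ ∑-cong q (λ t → trans (cong (proj₁ t *_) (short (proj₂ t) w |w|<2)) (ℤ.*-zeroʳ (proj₁ t))) ⟩
  ∑[ t ∈ q ] + 0
    ≡⟨ ∑-zero q ⟩
  + 0 ∎
  where
  open ≡-Reasoning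
  short : ∀ v w → length w < 2 → Xoccurrences v w ≡ + 0
  short v []          _                 = Xoccurrences-[] v
  short v (x ∷ [])    _                 = Xoccurrences-[x] v x
  short v (x ∷ y ∷ w) (s≤s (s≤s ()))

private
  reassoc : ∀ s t e w → s * t * (e * w) ≡ e * (s * (t * w))
  reassoc = solve-∀

abCoeff-X^k : ∀ k w → abCoeff (powCD X k) w ≡ 𝟙 (length w ≡ᵇ k ℕ.* 2) * wordSign w
abCoeff-X^k zero    []          = refl
abCoeff-X^k zero    (x ∷ w)     = refl
abCoeff-X^k (suc k) []          = abCoeff-X*-short (powCD X k) [] (s≤s z≤n)
abCoeff-X^k (suc k) (x ∷ [])    = abCoeff-X*-short (powCD X k) (x ∷ []) (s≤s (s≤s z≤n))
abCoeff-X^k (suc k) (x ∷ y ∷ u) = begin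
  abCoeff (X *cd powCD X k) (x ∷ y ∷ u)
    ≡⟨ abCoeff-X*-∷∷ (powCD X k) x y u ⟩
  letterSign x * letterSign y * abCoeff (powCD X k) u
    ≡⟨ cong (letterSign x * letterSign y *_) (abCoeff-X^k k u) ⟩
  letterSign x * letterSign y * (𝟙 (length u ≡ᵇ k ℕ.* 2) * wordSign u)
    ≡⟨ reassoc (letterSign x) (letterSign y) (𝟙 (length u ≡ᵇ k ℕ.* 2)) (wordSign u) ⟩
  𝟙 (length u ≡ᵇ k ℕ.* 2) * wordSign (x ∷ y ∷ u) ∎
  where open ≡-Reasoning

∑-*cP : ∀ q (f : ℤ × List CD → ℤ) →
        ∑ (q *cd cP) f ≡ ∑[ t ∈ q ] (f (proj₁ t * + 1 , proj₂ t ++ c ∷ []) + + 0)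
∑-*cP q f = trans (∑-concatMap _ q f) (∑-cong q (λ { (z , v) → refl }))

abCoeff-X*-*cP : ∀ q w → abCoeff ((X *cd q) *cd cP) w ≡ abCoeff (X *cd (q *cd cP)) w
abCoeff-X*-*cP q w = begin
  abCoeff ((X *cd q) *cd cP) w
    ≡⟨ ∑-*cP (X *cd q) f ⟩
  ∑[ t ∈ X *cd q ] (f (proj₁ t * + 1 , proj₂ t ++ c ∷ []) + + 0)
    ≡⟨ ∑-X* q (λ t → f (proj₁ t * + 1 , proj₂ t ++ c ∷ []) + + 0) ⟩
  ∑[ t ∈ q ] (f (+ 1 * proj₁ t * + 1 , c ∷ c ∷ proj₂ t ++ c ∷ []) + + 0
             + (f (-[1+ 1 ] * proj₁ t * + 1 , d ∷ proj₂ t ++ c ∷ []) + + 0))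
    ≡⟨ ∑-cong q (λ t → collect (proj₁ t) (occurrences (c ∷ c ∷ proj₂ t ++ c ∷ []) w)
                                          (occurrences (d ∷ proj₂ t ++ c ∷ []) w)) ⟩
  ∑[ t ∈ q ] (proj₁ t * + 1 * Xoccurrences (proj₂ t ++ c ∷ []) w + + 0)
    ≡⟨ sym (∑-*cP q (λ t → proj₁ t * Xoccurrences (proj₂ t) w)) ⟩
  ∑[ t ∈ q *cd cP ] proj₁ t * Xoccurrences (proj₂ t) w
    ≡⟨ sym (abCoeff-X* (q *cd cP) w) ⟩
  abCoeff (X *cd (q *cd cP)) w ∎
  where
  open ≡-Reasoning
  f : ℤ × List CD → ℤ
  f t = proj₁ t * occurrences (proj₂ t) w
  collect : ∀ z m n → + 1 * z * + 1 * m + + 0 + (-[1+ 1 ] * z * + 1 * n + + 0) ≡ z * + 1 * (m - + 2 * n) + + 0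
  collect = solve-∀

abCoeff-X^k*c : ∀ k w → abCoeff (powCD X k *cd cP) w ≡ 𝟙 (length w ≡ᵇ suc (k ℕ.* 2)) * wordSignInit w
abCoeff-X^k*c zero    []              = refl
abCoeff-X^k*c zero    (a ∷ [])        = refl
abCoeff-X^k*c zero    (b ∷ [])        = refl
abCoeff-X^k*c zero    (x ∷ y ∷ u)     = cong (λ o → + 1 * o + + 0) (occurrences-c∷ [] x (y ∷ u))
abCoeff-X^k*c (suc k) w = trans (abCoeff-X*-*cP (powCD X k) w) (step w)
  where
  open ≡-Reasoning
  step : ∀ w → abCoeff (X *cd (powCD X k *cd cP)) w ≡ 𝟙 (length w ≡ᵇ suc (suc k ℕ.* 2)) * wordSignInit w
  step []              = abCoeff-X*-short (powCD X k *cd cP) [] (s≤s z≤n)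
  step (x ∷ [])        = abCoeff-X*-short (powCD X k *cd cP) (x ∷ []) (s≤s (s≤s z≤n))
  step (x ∷ y ∷ [])    = begin
    abCoeff (X *cd (powCD X k *cd cP)) (x ∷ y ∷ [])
      ≡⟨ abCoeff-X*-∷∷ (powCD X k *cd cP) x y [] ⟩
    letterSign x * letterSign y * abCoeff (powCD X k *cd cP) []
      ≡⟨ cong (letterSign x * letterSign y *_) (abCoeff-X^k*c k []) ⟩
    letterSign x * letterSign y * + 0
      ≡⟨ ℤ.*-zeroʳ (letterSign x * letterSign y) ⟩
    + 0 ∎
  step (x ∷ y ∷ z ∷ u) = begin
    abCoeff (X *cd (powCD X k *cd cP)) (x ∷ y ∷ z ∷ u)
      ≡⟨ abCoeff-X*-∷∷ (powCD X k *cd cP) x y (z ∷ u) ⟩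
    letterSign x * letterSign y * abCoeff (powCD X k *cd cP) (z ∷ u)
      ≡⟨ cong (letterSign x * letterSign y *_) (abCoeff-X^k*c k (z ∷ u)) ⟩
    letterSign x * letterSign y * (𝟙 (length (z ∷ u) ≡ᵇ suc (k ℕ.* 2)) * wordSignInit (z ∷ u))
      ≡⟨ reassoc (letterSign x) (letterSign y) (𝟙 (length (z ∷ u) ≡ᵇ suc (k ℕ.* 2))) (wordSignInit (z ∷ u)) ⟩
    𝟙 (length (z ∷ u) ≡ᵇ suc (k ℕ.* 2)) * wordSignInit (x ∷ y ∷ z ∷ u) ∎

-- Counting chains in a finite ranked poset

module ChainCounting {P : Set} (elements : List P) (rk : P → ℕ) (_≼_ : P → P → Bool) where

  above : Maybe P → P → Bool
  above nothing  y = true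
  above (just x) y = x ≼ y

  -- chains x < y₁ < ⋯ < yₖ with rk yⱼ = tⱼ, where x = nothing stands for a bottom element
  chainsUp : Maybe P → List ℕ → ℤ
  chainsUp x []       = + 1
  chainsUp x (t ∷ ts) = ∑[ y ∈ elements ] 𝟙 ((rk y ≡ᵇ t) ∧ above x y) * chainsUp (just y) ts

  chainsBetween : Maybe P → List ℕ → P → ℤ
  chainsBetween x []       z = 𝟙 (above x z)
  chainsBetween x (t ∷ ts) z = ∑[ y ∈ elements ] 𝟙 ((rk y ≡ᵇ t) ∧ above x y) * chainsBetween (just y) ts z

  chainsDown : P → List ℕ → ℤ
  chainsDown z []       = + 1
  chainsDown z (r ∷ rs) = ∑[ y ∈ elements ] 𝟙 ((rk y ≡ᵇ r) ∧ (y ≼ z)) * chainsDown y rs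

  chainsUp-∷ʳ : ∀ x ts m → chainsUp x (ts ++ m ∷ []) ≡ ∑[ z ∈ elements ] 𝟙 (rk z ≡ᵇ m) * chainsBetween x ts z
  chainsUp-∷ʳ x []       m = ∑-cong elements (λ z → trans (ℤ.*-identityʳ _) (𝟙-∧ (rk z ≡ᵇ m) (above x z)))
  chainsUp-∷ʳ x (t ∷ ts) m =
    trans (∑-cong elements (λ y → cong (𝟙 ((rk y ≡ᵇ t) ∧ above x y) *_) (chainsUp-∷ʳ (just y) ts m)))
          (∑*∑-comm elements elements (λ y → 𝟙 ((rk y ≡ᵇ t) ∧ above x y)) (λ z → 𝟙 (rk z ≡ᵇ m))
                    (λ y z → chainsBetween (just y) ts z))

  chainsBetween-∷ʳ : ∀ x ts t z →
    chainsBetween x (ts ++ t ∷ []) z ≡ ∑[ y ∈ elements ] 𝟙 ((rk y ≡ᵇ t) ∧ (y ≼ z)) * chainsBetween x ts y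
  chainsBetween-∷ʳ x []        t z = ∑-cong elements (λ y → begin
    𝟙 ((rk y ≡ᵇ t) ∧ above x y) * 𝟙 (y ≼ z)
      ≡⟨ cong (_* 𝟙 (y ≼ z)) (𝟙-∧ (rk y ≡ᵇ t) (above x y)) ⟩
    𝟙 (rk y ≡ᵇ t) * 𝟙 (above x y) * 𝟙 (y ≼ z)
      ≡⟨ swap (𝟙 (rk y ≡ᵇ t)) (𝟙 (above x y)) (𝟙 (y ≼ z)) ⟩
    𝟙 (rk y ≡ᵇ t) * 𝟙 (y ≼ z) * 𝟙 (above x y)
      ≡⟨ cong (_* 𝟙 (above x y)) (sym (𝟙-∧ (rk y ≡ᵇ t) (y ≼ z))) ⟩
    𝟙 ((rk y ≡ᵇ t) ∧ (y ≼ z)) * 𝟙 (above x y) ∎)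
    where
    open ≡-Reasoning
    swap : ∀ p q r → p * q * r ≡ p * r * q
    swap = solve-∀
  chainsBetween-∷ʳ x (t′ ∷ ts) t z =
    trans (∑-cong elements (λ w → cong (𝟙 ((rk w ≡ᵇ t′) ∧ above x w) *_) (chainsBetween-∷ʳ (just w) ts t z)))
          (∑*∑-comm elements elements (λ w → 𝟙 ((rk w ≡ᵇ t′) ∧ above x w))
                    (λ y → 𝟙 ((rk y ≡ᵇ t) ∧ (y ≼ z)))
                    (λ w y → chainsBetween (just w) ts y))

  chainsBetween-reverse : ∀ rs z → chainsBetween nothing (reverse rs) z ≡ chainsDown z rs
  chainsBetween-reverse []       z = refl
  chainsBetween-reverse (r ∷ rs) z = begin
    chainsBetween nothing (reverse (r ∷ rs)) z
      ≡⟨ cong (λ l → chainsBetween nothing l z) (List.unfold-reverse r rs) ⟩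
    chainsBetween nothing (reverse rs ++ r ∷ []) z
      ≡⟨ chainsBetween-∷ʳ nothing (reverse rs) r z ⟩
    ∑[ y ∈ elements ] 𝟙 ((rk y ≡ᵇ r) ∧ (y ≼ z)) * chainsBetween nothing (reverse rs) y
      ≡⟨ ∑-cong elements (λ y → cong (𝟙 ((rk y ≡ᵇ r) ∧ (y ≼ z)) *_) (chainsBetween-reverse rs y)) ⟩
    chainsDown z (r ∷ rs) ∎
    where open ≡-Reasoning

  chainsUp-reverse : ∀ m rs →
                     chainsUp nothing (reverse (m ∷ rs)) ≡ ∑[ z ∈ elements ] 𝟙 (rk z ≡ᵇ m) * chainsDown z rs
  chainsUp-reverse m rs = begin
    chainsUp nothing (reverse (m ∷ rs))
      ≡⟨ cong (chainsUp nothing) (List.unfold-reverse m rs) ⟩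
    chainsUp nothing (reverse rs ++ m ∷ [])
      ≡⟨ chainsUp-∷ʳ nothing (reverse rs) m ⟩
    ∑[ z ∈ elements ] 𝟙 (rk z ≡ᵇ m) * chainsBetween nothing (reverse rs) z
      ≡⟨ ∑-cong elements (λ z → cong (𝟙 (rk z ≡ᵇ m) *_) (chainsBetween-reverse rs z)) ⟩
    ∑[ z ∈ elements ] 𝟙 (rk z ≡ᵇ m) * chainsDown z rs ∎
    where open ≡-Reasoning

anyFin : ∀ {L} → (Fin L → Bool) → Bool
anyFin {zero}  h = false
anyFin {suc L} h = h fzero ∨ anyFin (λ k → h (fsuc k))

anyL-tabulate : ∀ {L} (h : A → Bool) (f : Fin L → A) → anyL h (tabulate f) ≡ anyFin (λ k → h (f k))
anyL-tabulate {L = zero}  h f = refl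
anyL-tabulate {L = suc L} h f = cong (h (f fzero) ∨_) (anyL-tabulate h (λ k → f (fsuc k)))

anyFin-cong : ∀ {L} {h h′ : Fin L → Bool} → (∀ k → h k ≡ h′ k) → anyFin h ≡ anyFin h′
anyFin-cong {zero}  h≡h′ = refl
anyFin-cong {suc L} h≡h′ = cong₂ _∨_ (h≡h′ fzero) (anyFin-cong (λ k → h≡h′ (fsuc k)))

anyFin-∧ˡ : ∀ {L} (p : Bool) (h : Fin L → Bool) → anyFin (λ k → p ∧ h k) ≡ p ∧ anyFin h
anyFin-∧ˡ {zero}  p     h = sym (∧-zeroʳ p)
anyFin-∧ˡ {suc L} true  h = cong (h fzero ∨_) (anyFin-∧ˡ true (λ k → h (fsuc k)))
anyFin-∧ˡ {suc L} false h = anyFin-∧ˡ false (λ k → h (fsuc k))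

anyFin-∧ʳ : ∀ {L} (p : Bool) (h : Fin L → Bool) → anyFin (λ k → h k ∧ p) ≡ anyFin h ∧ p
anyFin-∧ʳ p h = trans (anyFin-cong (λ k → ∧-comm (h k) p)) (trans (anyFin-∧ˡ p h) (∧-comm p (anyFin h)))

missesWhere : ∀ {L} → (ℕ → Bool) → Vec Bool L → Bool
missesWhere g []      = false
missesWhere g (x ∷ F) = (g 0 ∧ not x) ∨ missesWhere (λ k → g (suc k)) F

anyFin-misses : ∀ {L} (F : Vec Bool L) (g : ℕ → Bool) → anyFin (λ k → g (toℕ k) ∧ not (lookup F k)) ≡ missesWhere g F
anyFin-misses []      g = refl
anyFin-misses (x ∷ F) g = cong ((g 0 ∧ not x) ∨_) (anyFin-misses F (λ k → g (suc k)))

missesWhere-cong : ∀ {L} (F : Vec Bool L) {g g′ : ℕ → Bool} → (∀ k → g k ≡ g′ k) →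
                   missesWhere g F ≡ missesWhere g′ F
missesWhere-cong []      g≡g′ = refl
missesWhere-cong (x ∷ F) g≡g′ =
  cong₂ (λ p q → (p ∧ not x) ∨ q) (g≡g′ 0) (missesWhere-cong F (λ k → g≡g′ (suc k)))

missesWhere-false : ∀ {L} (F : Vec Bool L) → missesWhere (λ _ → false) F ≡ false
missesWhere-false []      = refl
missesWhere-false (x ∷ F) = missesWhere-false F

missesSome : ∀ {L} → Vec Bool L → Bool
missesSome []      = false
missesSome (x ∷ F) = not x ∨ missesSome F

missesUpTo : ∀ {L} → ℕ → Vec Bool L → Bool
missesUpTo i       []      = false
missesUpTo zero    (x ∷ F) = not x
missesUpTo (suc i) (x ∷ F) = not x ∨ missesUpTo i F

missesAbove : ∀ {L} → ℕ → Vec Bool L → Bool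
missesAbove i       []      = false
missesAbove zero    (x ∷ F) = missesSome F
missesAbove (suc i) (x ∷ F) = missesAbove i F

firstMissing : ∀ {L} → ℕ → Vec Bool L → Bool
firstMissing i       []      = false
firstMissing zero    (x ∷ F) = not x
firstMissing (suc i) (x ∷ F) = x ∧ firstMissing i F

missesWhere-true : ∀ {L} (F : Vec Bool L) → missesWhere (λ _ → true) F ≡ missesSome F
missesWhere-true []      = refl
missesWhere-true (x ∷ F) = cong (not x ∨_) (missesWhere-true F)

missesWhere-≤ᵇ : ∀ {L} (F : Vec Bool L) i → missesWhere (_≤ᵇ i) F ≡ missesUpTo i F
missesWhere-≤ᵇ []      i       = refl
missesWhere-≤ᵇ (x ∷ F) zero    = trans (cong (not x ∨_) (missesWhere-false F)) (∨-identityʳ (not x))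
missesWhere-≤ᵇ (x ∷ F) (suc i) = cong (not x ∨_) (trans (missesWhere-cong F (λ k → <ᵇ-suc k i)) (missesWhere-≤ᵇ F i))
  where
  <ᵇ-suc : ∀ k i → (k <ᵇ suc i) ≡ (k ≤ᵇ i)
  <ᵇ-suc zero    i = refl
  <ᵇ-suc (suc k) i = refl

missesWhere-<ᵇ : ∀ {L} (F : Vec Bool L) i → missesWhere (i <ᵇ_) F ≡ missesAbove i F
missesWhere-<ᵇ []      i       = refl
missesWhere-<ᵇ (x ∷ F) zero    = missesWhere-true F
missesWhere-<ᵇ (x ∷ F) (suc i) = missesWhere-<ᵇ F i

inGammaᵇ≡ : ∀ n i (F : Vec Bool (suc n)) → inGammaᵇ n i F ≡ (1 ≤ᵇ card F) ∧ missesUpTo i F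
inGammaᵇ≡ n i F = cong ((1 ≤ᵇ card F) ∧_) (begin
  anyL (λ k → (toℕ k ≤ᵇ i) ∧ misses F k) (allFin (suc n))
    ≡⟨ anyL-tabulate (λ k → (toℕ k ≤ᵇ i) ∧ misses F k) (λ k → k) ⟩
  anyFin (λ k → (toℕ k ≤ᵇ i) ∧ misses F k)
    ≡⟨ anyFin-misses F (_≤ᵇ i) ⟩
  missesWhere (_≤ᵇ i) F
    ≡⟨ missesWhere-≤ᵇ F i ⟩
  missesUpTo i F ∎)
  where open ≡-Reasoning

inBoundaryᵇ≡ : ∀ n i (F : Vec Bool (suc n)) →
               inBoundaryᵇ n i F ≡ (1 ≤ᵇ card F) ∧ (missesUpTo i F ∧ missesAbove i F)
inBoundaryᵇ≡ n i F = cong ((1 ≤ᵇ card F) ∧_) (begin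
  anyL (λ j → anyL (R j) (allFin (suc n))) (allFin (suc n))
    ≡⟨ anyL-tabulate (λ j → anyL (R j) (allFin (suc n))) (λ k → k) ⟩
  anyFin (λ j → anyL (R j) (allFin (suc n)))
    ≡⟨ anyFin-cong (λ j → trans (anyL-tabulate (R j) (λ k → k))
                                (anyFin-cong (λ k → shuffle (toℕ j ≤ᵇ i) (i <ᵇ toℕ k) (misses F j) (misses F k)))) ⟩
  anyFin (λ j → anyFin (λ k → below j ∧ above k))
    ≡⟨ anyFin-cong (λ j → anyFin-∧ˡ (below j) above) ⟩
  anyFin (λ j → below j ∧ anyFin above)
    ≡⟨ anyFin-∧ʳ (anyFin above) below ⟩
  anyFin below ∧ anyFin above
    ≡⟨ cong₂ _∧_ (trans (anyFin-misses F (_≤ᵇ i)) (missesWhere-≤ᵇ F i))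
                 (trans (anyFin-misses F (i <ᵇ_)) (missesWhere-<ᵇ F i)) ⟩
  missesUpTo i F ∧ missesAbove i F ∎)
  where
  open ≡-Reasoning
  R : Fin (suc n) → Fin (suc n) → Bool
  R j k = (toℕ j ≤ᵇ i) ∧ (i <ᵇ toℕ k) ∧ misses F j ∧ misses F k
  below above : Fin (suc n) → Bool
  below j = (toℕ j ≤ᵇ i) ∧ misses F j
  above k = (i <ᵇ toℕ k) ∧ misses F k
  shuffle : ∀ p q r s → (p ∧ q ∧ r ∧ s) ≡ ((p ∧ r) ∧ (q ∧ s))
  shuffle true  true  r s = refl
  shuffle true  false r s = sym (∧-zeroʳ r)
  shuffle false q     r s = refl

∑-allSubsets-suc : ∀ L (h : Vec Bool (suc L) → ℤ) →
  ∑ (allSubsets (suc L)) h ≡ (∑[ F ∈ allSubsets L ] h (true ∷ F)) + (∑[ F ∈ allSubsets L ] h (false ∷ F))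
∑-allSubsets-suc L h =
  trans (∑-++ (map (true ∷_) (allSubsets L)) _ h)
        (cong₂ _+_ (∑-map (true ∷_) (allSubsets L) h) (∑-map (false ∷_) (allSubsets L) h))

count-card : ∀ L r → ∑[ F ∈ allSubsets L ] 𝟙 (card F ≡ᵇ r) ≡ + binomial L r
count-card zero    zero    = refl
count-card zero    (suc r) = refl
count-card (suc L) zero    = begin
  ∑[ F ∈ allSubsets (suc L) ] 𝟙 (card F ≡ᵇ 0)
    ≡⟨ ∑-allSubsets-suc L (λ F → 𝟙 (card F ≡ᵇ 0)) ⟩
  (∑[ F ∈ allSubsets L ] + 0) + (∑[ F ∈ allSubsets L ] 𝟙 (card F ≡ᵇ 0))
    ≡⟨ cong₂ _+_ (∑-zero (allSubsets L)) (count-card L 0) ⟩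
  + 1 ∎
  where open ≡-Reasoning
count-card (suc L) (suc r) = begin
  ∑[ F ∈ allSubsets (suc L) ] 𝟙 (card F ≡ᵇ suc r)
    ≡⟨ ∑-allSubsets-suc L (λ F → 𝟙 (card F ≡ᵇ suc r)) ⟩
  (∑[ F ∈ allSubsets L ] 𝟙 (card F ≡ᵇ r)) + (∑[ F ∈ allSubsets L ] 𝟙 (card F ≡ᵇ suc r))
    ≡⟨ cong₂ _+_ (count-card L r) (count-card L (suc r)) ⟩
  + binomial L r + + binomial L (suc r)
    ≡⟨ sym (ℤ.pos-+ (binomial L r) (binomial L (suc r))) ⟩
  + binomial (suc L) (suc r) ∎
  where open ≡-Reasoning

count-subsets : ∀ {L} (F : Vec Bool L) r →
                ∑[ G ∈ allSubsets L ] 𝟙 ((card G ≡ᵇ r) ∧ subsetᵇ G F) ≡ + binomial (card F) r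
count-subsets []           zero    = refl
count-subsets []           (suc r) = refl
count-subsets {suc L} (true ∷ F) zero = begin
  ∑[ G ∈ allSubsets (suc L) ] 𝟙 ((card G ≡ᵇ 0) ∧ subsetᵇ G (true ∷ F))
    ≡⟨ ∑-allSubsets-suc L (λ G → 𝟙 ((card G ≡ᵇ 0) ∧ subsetᵇ G (true ∷ F))) ⟩
  (∑[ G ∈ allSubsets L ] + 0) + (∑[ G ∈ allSubsets L ] 𝟙 ((card G ≡ᵇ 0) ∧ subsetᵇ G F))
    ≡⟨ cong₂ _+_ (∑-zero (allSubsets L)) (count-subsets F zero) ⟩
  + 1 ∎
  where open ≡-Reasoning
count-subsets {suc L} (true ∷ F) (suc r) = begin
  ∑[ G ∈ allSubsets (suc L) ] 𝟙 ((card G ≡ᵇ suc r) ∧ subsetᵇ G (true ∷ F))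
    ≡⟨ ∑-allSubsets-suc L (λ G → 𝟙 ((card G ≡ᵇ suc r) ∧ subsetᵇ G (true ∷ F))) ⟩
  (∑[ G ∈ allSubsets L ] 𝟙 ((card G ≡ᵇ r) ∧ subsetᵇ G F))
    + (∑[ G ∈ allSubsets L ] 𝟙 ((card G ≡ᵇ suc r) ∧ subsetᵇ G F))
    ≡⟨ cong₂ _+_ (count-subsets F r) (count-subsets F (suc r)) ⟩
  + binomial (card F) r + + binomial (card F) (suc r)
    ≡⟨ sym (ℤ.pos-+ (binomial (card F) r) (binomial (card F) (suc r))) ⟩
  + binomial (suc (card F)) (suc r) ∎
  where open ≡-Reasoning
count-subsets {suc L} (false ∷ F) r = begin
  ∑[ G ∈ allSubsets (suc L) ] 𝟙 ((card G ≡ᵇ r) ∧ subsetᵇ G (false ∷ F))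
    ≡⟨ ∑-allSubsets-suc L (λ G → 𝟙 ((card G ≡ᵇ r) ∧ subsetᵇ G (false ∷ F))) ⟩
  (∑[ G ∈ allSubsets L ] 𝟙 ((suc (card G) ≡ᵇ r) ∧ false))
    + (∑[ G ∈ allSubsets L ] 𝟙 ((card G ≡ᵇ r) ∧ subsetᵇ G F))
    ≡⟨ cong (_+ (∑[ G ∈ allSubsets L ] 𝟙 ((card G ≡ᵇ r) ∧ subsetᵇ G F)))
            (trans (∑-cong (allSubsets L) (λ G → cong 𝟙 (∧-zeroʳ (suc (card G) ≡ᵇ r)))) (∑-zero (allSubsets L))) ⟩
  + 0 + (∑[ G ∈ allSubsets L ] 𝟙 ((card G ≡ᵇ r) ∧ subsetᵇ G F))
    ≡⟨ ℤ.+-identityˡ _ ⟩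
  ∑[ G ∈ allSubsets L ] 𝟙 ((card G ≡ᵇ r) ∧ subsetᵇ G F)
    ≡⟨ count-subsets F r ⟩
  + binomial (card F) r ∎
  where open ≡-Reasoning

count-firstMissing : ∀ L m i → ∑[ F ∈ allSubsets (suc L) ] 𝟙 (firstMissing i F) * 𝟙 (card F ≡ᵇ m) ≡ + C↓ L m i
count-firstMissing L m zero = begin
  ∑[ F ∈ allSubsets (suc L) ] 𝟙 (firstMissing 0 F) * 𝟙 (card F ≡ᵇ m)
    ≡⟨ ∑-allSubsets-suc L (λ F → 𝟙 (firstMissing 0 F) * 𝟙 (card F ≡ᵇ m)) ⟩
  (∑[ F ∈ allSubsets L ] + 0) + (∑[ F ∈ allSubsets L ] + 1 * 𝟙 (card F ≡ᵇ m))
    ≡⟨ cong₂ _+_ (∑-zero (allSubsets L)) (∑-cong (allSubsets L) (λ F → ℤ.*-identityˡ _)) ⟩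
  + 0 + (∑[ F ∈ allSubsets L ] 𝟙 (card F ≡ᵇ m))
    ≡⟨ trans (ℤ.+-identityˡ _) (count-card L m) ⟩
  + binomial L m ∎
  where open ≡-Reasoning
count-firstMissing L zero (suc i) = begin
  ∑[ F ∈ allSubsets (suc L) ] 𝟙 (firstMissing (suc i) F) * 𝟙 (card F ≡ᵇ 0)
    ≡⟨ ∑-allSubsets-suc L (λ F → 𝟙 (firstMissing (suc i) F) * 𝟙 (card F ≡ᵇ 0)) ⟩
  (∑[ F ∈ allSubsets L ] 𝟙 (firstMissing i F) * + 0) + (∑[ F ∈ allSubsets L ] + 0)
    ≡⟨ cong₂ _+_ (trans (∑-cong (allSubsets L) (λ F → ℤ.*-zeroʳ (𝟙 (firstMissing i F)))) (∑-zero (allSubsets L)))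
                 (∑-zero (allSubsets L)) ⟩
  + 0
    ≡⟨ cong +_ (sym (m<i⇒C↓≡0 L (s≤s z≤n))) ⟩
  + C↓ L 0 (suc i) ∎
  where open ≡-Reasoning
count-firstMissing zero    (suc m) (suc i) = refl
count-firstMissing (suc L) (suc m) (suc i) = begin
  ∑[ F ∈ allSubsets (suc (suc L)) ] 𝟙 (firstMissing (suc i) F) * 𝟙 (card F ≡ᵇ suc m)
    ≡⟨ ∑-allSubsets-suc (suc L) (λ F → 𝟙 (firstMissing (suc i) F) * 𝟙 (card F ≡ᵇ suc m)) ⟩
  (∑[ F ∈ allSubsets (suc L) ] 𝟙 (firstMissing i F) * 𝟙 (card F ≡ᵇ m)) + (∑[ F ∈ allSubsets (suc L) ] + 0)
    ≡⟨ cong₂ _+_ (count-firstMissing L m i) (∑-zero (allSubsets (suc L))) ⟩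
  + C↓ L m i + + 0
    ≡⟨ ℤ.+-identityʳ _ ⟩
  + C↓ L m i ∎
  where open ≡-Reasoning

missesUpTo-0 : ∀ {L} (F : Vec Bool L) → missesUpTo 0 F ≡ firstMissing 0 F
missesUpTo-0 []      = refl
missesUpTo-0 (x ∷ F) = refl

𝟙-missesUpTo-suc : ∀ {L} i (F : Vec Bool L) →
                   𝟙 (missesUpTo (suc i) F) ≡ 𝟙 (missesUpTo i F) + 𝟙 (firstMissing (suc i) F)
𝟙-missesUpTo-suc i       []          = refl
𝟙-missesUpTo-suc zero    (false ∷ F) = refl
𝟙-missesUpTo-suc (suc i) (false ∷ F) = refl
𝟙-missesUpTo-suc zero    (true ∷ F)  = trans (cong 𝟙 (missesUpTo-0 F)) (sym (ℤ.+-identityˡ _))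
𝟙-missesUpTo-suc (suc i) (true ∷ F)  = 𝟙-missesUpTo-suc i F

missesUpTo-⊆ : ∀ {L} i (G F : Vec Bool L) → subsetᵇ G F ≡ true → missesUpTo i F ≡ true → missesUpTo i G ≡ true
missesUpTo-⊆ zero    (false ∷ G) (y ∷ F)     _   _   = refl
missesUpTo-⊆ zero    (true ∷ G)  (true ∷ F)  _   ()
missesUpTo-⊆ zero    (true ∷ G)  (false ∷ F) ()  _
missesUpTo-⊆ (suc i) (false ∷ G) (y ∷ F)     _   _   = refl
missesUpTo-⊆ (suc i) (true ∷ G)  (false ∷ F) ()  _
missesUpTo-⊆ (suc i) (true ∷ G)  (true ∷ F)  G⊆F F∈ = missesUpTo-⊆ i G F G⊆F F∈

missesUpTo∨missesAbove : ∀ {L} i (F : Vec Bool L) → i < L → (missesUpTo i F ∨ missesAbove i F) ≡ missesSome F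
missesUpTo∨missesAbove zero    (x ∷ F) _         = refl
missesUpTo∨missesAbove (suc i) (x ∷ F) (s≤s i<L) = trans (∨-assoc (not x) (missesUpTo i F) (missesAbove i F))
                                                         (cong (not x ∨_) (missesUpTo∨missesAbove i F i<L))

missesSome≡false⇒card≡L : ∀ {L} (F : Vec Bool L) → missesSome F ≡ false → card F ≡ L
missesSome≡false⇒card≡L []         _   = refl
missesSome≡false⇒card≡L (true ∷ F) all = cong suc (missesSome≡false⇒card≡L F all)

∑-missesNone : ∀ L (h : ℕ → ℤ) → ∑[ F ∈ allSubsets L ] 𝟙 (not (missesSome F)) * h (card F) ≡ h L
∑-missesNone zero    h = trans (ℤ.+-identityʳ _) (ℤ.*-identityˡ (h 0))
∑-missesNone (suc L) h = begin
  ∑[ F ∈ allSubsets (suc L) ] 𝟙 (not (missesSome F)) * h (card F)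
    ≡⟨ ∑-allSubsets-suc L (λ F → 𝟙 (not (missesSome F)) * h (card F)) ⟩
  (∑[ F ∈ allSubsets L ] 𝟙 (not (missesSome F)) * h (suc (card F))) + (∑[ F ∈ allSubsets L ] + 0)
    ≡⟨ cong₂ _+_ (∑-missesNone L (λ k → h (suc k))) (∑-zero (allSubsets L)) ⟩
  h (suc L) + + 0
    ≡⟨ ℤ.+-identityʳ _ ⟩
  h (suc L) ∎
  where open ≡-Reasoning

C↓-L-L : ∀ L r → + C↓ (suc L) r L ≡ 𝟙 (suc L ≡ᵇ r) + 𝟙 (L ≡ᵇ r)
C↓-L-L zero    zero          = refl
C↓-L-L zero    (suc zero)    = refl
C↓-L-L zero    (suc (suc r)) = refl
C↓-L-L (suc L) zero          = refl
C↓-L-L (suc L) (suc r)       = C↓-L-L L r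

count-containsAbove : ∀ L i r → i < L →
                      ∑[ F ∈ allSubsets L ] 𝟙 (not (missesAbove i F)) * 𝟙 (card F ≡ᵇ r) ≡ + C↓ L r (L ∸ suc i)
count-containsAbove (suc L) zero r _ = begin
  ∑[ F ∈ allSubsets (suc L) ] 𝟙 (not (missesAbove 0 F)) * 𝟙 (card F ≡ᵇ r)
    ≡⟨ ∑-allSubsets-suc L (λ F → 𝟙 (not (missesAbove 0 F)) * 𝟙 (card F ≡ᵇ r)) ⟩
  (∑[ F ∈ allSubsets L ] 𝟙 (not (missesSome F)) * 𝟙 (suc (card F) ≡ᵇ r))
    + (∑[ F ∈ allSubsets L ] 𝟙 (not (missesSome F)) * 𝟙 (card F ≡ᵇ r))
    ≡⟨ cong₂ _+_ (∑-missesNone L (λ k → 𝟙 (suc k ≡ᵇ r))) (∑-missesNone L (λ k → 𝟙 (k ≡ᵇ r))) ⟩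
  𝟙 (suc L ≡ᵇ r) + 𝟙 (L ≡ᵇ r)
    ≡⟨ sym (C↓-L-L L r) ⟩
  + C↓ (suc L) r L ∎
  where open ≡-Reasoning
count-containsAbove (suc L) (suc i) zero (s≤s i<L) = begin
  ∑[ F ∈ allSubsets (suc L) ] 𝟙 (not (missesAbove (suc i) F)) * 𝟙 (card F ≡ᵇ 0)
    ≡⟨ ∑-allSubsets-suc L (λ F → 𝟙 (not (missesAbove (suc i) F)) * 𝟙 (card F ≡ᵇ 0)) ⟩
  (∑[ F ∈ allSubsets L ] 𝟙 (not (missesAbove i F)) * + 0)
    + (∑[ F ∈ allSubsets L ] 𝟙 (not (missesAbove i F)) * 𝟙 (card F ≡ᵇ 0))
    ≡⟨ cong₂ _+_ (trans (∑-cong (allSubsets L) (λ F → ℤ.*-zeroʳ (𝟙 (not (missesAbove i F)))))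
                        (∑-zero (allSubsets L)))
                 (count-containsAbove L i zero i<L) ⟩
  + 0 + + C↓ L 0 (L ∸ suc i)
    ≡⟨ ℤ.+-identityˡ _ ⟩
  + C↓ L 0 (L ∸ suc i)
    ≡⟨ cong +_ (sym (C↓-suc-0 (ℕ.m∸n≤m L (suc i)))) ⟩
  + C↓ (suc L) 0 (L ∸ suc i) ∎
  where open ≡-Reasoning
count-containsAbove (suc L) (suc i) (suc r) (s≤s i<L) = begin
  ∑[ F ∈ allSubsets (suc L) ] 𝟙 (not (missesAbove (suc i) F)) * 𝟙 (card F ≡ᵇ suc r)
    ≡⟨ ∑-allSubsets-suc L (λ F → 𝟙 (not (missesAbove (suc i) F)) * 𝟙 (card F ≡ᵇ suc r)) ⟩
  (∑[ F ∈ allSubsets L ] 𝟙 (not (missesAbove i F)) * 𝟙 (card F ≡ᵇ r))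
    + (∑[ F ∈ allSubsets L ] 𝟙 (not (missesAbove i F)) * 𝟙 (card F ≡ᵇ suc r))
    ≡⟨ cong₂ _+_ (count-containsAbove L i r i<L) (count-containsAbove L i (suc r) i<L) ⟩
  + C↓ L r (L ∸ suc i) + + C↓ L (suc r) (L ∸ suc i)
    ≡⟨ sym (ℤ.pos-+ (C↓ L r (L ∸ suc i)) _) ⟩
  + (C↓ L r (L ∸ suc i) ℕ.+ C↓ L (suc r) (L ∸ suc i))
    ≡⟨ cong +_ (trans (ℕ.+-comm (C↓ L r (L ∸ suc i)) _) (sym (C↓-pascal r (ℕ.m∸n≤m L (suc i))))) ⟩
  + C↓ (suc L) (suc r) (L ∸ suc i) ∎
  where open ≡-Reasoning

∑-cells : ∀ n i (h : Cell n → ℤ) →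
          ∑ (cells n i) h ≡ h tau + (∑[ G ∈ allSubsets (suc n) ] 𝟙 (inGammaᵇ n i G) * h (face G))
∑-cells n i h = cong (_+_ (h tau)) (begin
  ∑ (map face (filterB (inGammaᵇ n i) (allSubsets (suc n)))) h
    ≡⟨ ∑-map face (filterB (inGammaᵇ n i) (allSubsets (suc n))) h ⟩
  ∑[ G ∈ filterB (inGammaᵇ n i) (allSubsets (suc n)) ] h (face G)
    ≡⟨ ∑-filter (inGammaᵇ n i) (allSubsets (suc n)) (λ G → h (face G)) ⟩
  ∑[ G ∈ allSubsets (suc n) ] 𝟙 (inGammaᵇ n i G) * h (face G) ∎)
  where open ≡-Reasoning

inGammaᵇ-⊆ : ∀ n i (G F : Vec Bool (suc n)) → subsetᵇ G F ≡ true → inGammaᵇ n i F ≡ true →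
             (1 ≤ᵇ card G) ≡ true → inGammaᵇ n i G ≡ true
inGammaᵇ-⊆ n i G F G⊆F F∈Γ G≢∅ = begin
  inGammaᵇ n i G
    ≡⟨ inGammaᵇ≡ n i G ⟩
  (1 ≤ᵇ card G) ∧ missesUpTo i G
    ≡⟨ cong₂ _∧_ G≢∅ (missesUpTo-⊆ i G F G⊆F (∧-conicalʳ _ _ (trans (sym (inGammaᵇ≡ n i F)) F∈Γ))) ⟩
  true ∎
  where open ≡-Reasoning

-- the number of chains of subsets below an f-element set with ranks rs
simplexChains : ℕ → List ℕ → ℤ
simplexChains f []       = + 1
simplexChains f (r ∷ rs) = + binomial f r * simplexChains r rs

faceCount : ℕ → ℕ → ℕ → ℤ
faceCount n i m = ∑[ F ∈ allSubsets (suc n) ] 𝟙 (inGammaᵇ n i F) * 𝟙 (card F ≡ᵇ m)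

boundaryCount : ℕ → ℕ → ℕ → ℤ
boundaryCount n i r = ∑[ F ∈ allSubsets (suc n) ] 𝟙 (inGammaᵇ n i F) * 𝟙 ((card F ≡ᵇ r) ∧ inBoundaryᵇ n i F)

module FacePoset (n i : ℕ) where

  open ChainCounting (cells n i) rank (leqᵇ n i) public

  private
    subsets : List (Vec Bool (suc n))
    subsets = allSubsets (suc n)

    +-sumℕ-if : ∀ ts (e : Cell n → Bool) → (∀ y → + chainsAbove n i (just y) ts ≡ chainsUp (just y) ts) →
                + sumℕ (map (λ y → if e y then chainsAbove n i (just y) ts else 0) (cells n i))
                ≡ ∑[ y ∈ cells n i ] 𝟙 (e y) * chainsUp (just y) ts
    +-sumℕ-if ts e ih = trans (+-sumℕ (cells n i) _) (∑-cong (cells n i) term)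
      where
      term : ∀ y → + (if e y then chainsAbove n i (just y) ts else 0) ≡ 𝟙 (e y) * chainsUp (just y) ts
      term y with e y
      ... | true  = trans (ih y) (sym (ℤ.*-identityˡ _))
      ... | false = refl

  chainsAbove≡chainsUp : ∀ x ts → + chainsAbove n i x ts ≡ chainsUp x ts
  chainsAbove≡chainsUp x        []       = refl
  chainsAbove≡chainsUp nothing  (t ∷ ts) =
    +-sumℕ-if ts (λ y → (rank y ≡ᵇ t) ∧ true) (λ y → chainsAbove≡chainsUp (just y) ts)
  chainsAbove≡chainsUp (just x) (t ∷ ts) =
    +-sumℕ-if ts (λ y → (rank y ≡ᵇ t) ∧ leqᵇ n i x y) (λ y → chainsAbove≡chainsUp (just y) ts)

  mutual
    chainsDown-face : ∀ rs (F : Vec Bool (suc n)) → inGammaᵇ n i F ≡ true → All (1 ≤_) rs →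
                      chainsDown (face F) rs ≡ simplexChains (card F) rs
    chainsDown-face []       F F∈Γ _           = refl
    chainsDown-face (r ∷ rs) F F∈Γ (1≤r ∷ 1≤rs) = begin
      chainsDown (face F) (r ∷ rs)
        ≡⟨ ∑-cells n i (λ x → 𝟙 ((rank x ≡ᵇ r) ∧ leqᵇ n i x (face F)) * chainsDown x rs) ⟩
      𝟙 ((n ≡ᵇ r) ∧ false) * chainsDown tau rs
        + (∑[ G ∈ subsets ] 𝟙 (inGammaᵇ n i G) * (𝟙 (below G) * chainsDown (face G) rs))
        ≡⟨ cong₂ _+_ (cong (λ e → 𝟙 e * chainsDown tau rs) (∧-zeroʳ (n ≡ᵇ r)))
                     (∑-cong subsets (λ G → faceTerm r rs (λ G → subsetᵇ G F) G 1≤rs)) ⟩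
      + 0 * chainsDown tau rs + (∑[ G ∈ subsets ] 𝟙 (inGammaᵇ n i G) * 𝟙 (below G) * simplexChains r rs)
        ≡⟨ ℤ.+-identityˡ _ ⟩
      ∑[ G ∈ subsets ] 𝟙 (inGammaᵇ n i G) * 𝟙 (below G) * simplexChains r rs
        ≡⟨ ∑-cong subsets (λ G → cong (_* simplexChains r rs) (subfaceInΓ G)) ⟩
      ∑[ G ∈ subsets ] 𝟙 (below G) * simplexChains r rs
        ≡⟨ ∑-*ʳ subsets (λ G → 𝟙 (below G)) (simplexChains r rs) ⟩
      (∑[ G ∈ subsets ] 𝟙 (below G)) * simplexChains r rs
        ≡⟨ cong (_* simplexChains r rs) (count-subsets F r) ⟩
      simplexChains (card F) (r ∷ rs) ∎
      where
      open ≡-Reasoning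
      below : Vec Bool (suc n) → Bool
      below G = (card G ≡ᵇ r) ∧ subsetᵇ G F
      subfaceInΓ : ∀ G → 𝟙 (inGammaᵇ n i G) * 𝟙 (below G) ≡ 𝟙 (below G)
      subfaceInΓ G with card G ≡ᵇ r in |G|≡r | subsetᵇ G F in G⊆F
      ... | false | _     = ℤ.*-zeroʳ (𝟙 (inGammaᵇ n i G))
      ... | true  | false = ℤ.*-zeroʳ (𝟙 (inGammaᵇ n i G))
      ... | true  | true
        rewrite inGammaᵇ-⊆ n i G F G⊆F F∈Γ (1≤⇒1≤ᵇ (subst (1 ≤_) (sym (≡ᵇ≡true⇒≡ {card G} |G|≡r)) 1≤r)) = refl

    faceTerm : ∀ r rs (p : Vec Bool (suc n) → Bool) G → All (1 ≤_) rs →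
               𝟙 (inGammaᵇ n i G) * (𝟙 ((card G ≡ᵇ r) ∧ p G) * chainsDown (face G) rs)
               ≡ 𝟙 (inGammaᵇ n i G) * 𝟙 ((card G ≡ᵇ r) ∧ p G) * simplexChains r rs
    faceTerm r rs p G 1≤rs with inGammaᵇ n i G in G∈Γ | card G ≡ᵇ r in |G|≡r | p G
    ... | true  | true  | true  =
      trans (cong (λ x → + 1 * (+ 1 * x))
                  (trans (chainsDown-face rs G G∈Γ 1≤rs) (cong (λ k → simplexChains k rs) (≡ᵇ≡true⇒≡ |G|≡r))))
            (sym (ℤ.*-assoc (+ 1) (+ 1) (simplexChains r rs)))
    ... | true  | true  | false = refl
    ... | true  | false | _     = refl
    ... | false | _     | _     = refl

  chainsDown-tau : ∀ r rs → (n ≡ᵇ r) ≡ false → All (1 ≤_) rs →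
                   chainsDown tau (r ∷ rs) ≡ boundaryCount n i r * simplexChains r rs
  chainsDown-tau r rs n≢r 1≤rs = begin
    chainsDown tau (r ∷ rs)
      ≡⟨ ∑-cells n i (λ x → 𝟙 ((rank x ≡ᵇ r) ∧ leqᵇ n i x tau) * chainsDown x rs) ⟩
    𝟙 ((n ≡ᵇ r) ∧ true) * chainsDown tau rs
      + (∑[ G ∈ subsets ] 𝟙 (inGammaᵇ n i G) * (𝟙 ((card G ≡ᵇ r) ∧ inBoundaryᵇ n i G) * chainsDown (face G) rs))
      ≡⟨ cong₂ _+_ (cong (λ e → 𝟙 (e ∧ true) * chainsDown tau rs) n≢r)
                   (∑-cong subsets (λ G → faceTerm r rs (inBoundaryᵇ n i) G 1≤rs)) ⟩
    + 0 * chainsDown tau rs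
      + (∑[ G ∈ subsets ] 𝟙 (inGammaᵇ n i G) * 𝟙 ((card G ≡ᵇ r) ∧ inBoundaryᵇ n i G) * simplexChains r rs)
      ≡⟨ ℤ.+-identityˡ _ ⟩
    ∑[ G ∈ subsets ] 𝟙 (inGammaᵇ n i G) * 𝟙 ((card G ≡ᵇ r) ∧ inBoundaryᵇ n i G) * simplexChains r rs
      ≡⟨ ∑-*ʳ subsets (λ G → 𝟙 (inGammaᵇ n i G) * 𝟙 ((card G ≡ᵇ r) ∧ inBoundaryᵇ n i G)) (simplexChains r rs) ⟩
    boundaryCount n i r * simplexChains r rs ∎
    where open ≡-Reasoning

  flagF≡ : ∀ T m rs → ranks 1 T ≡ reverse (m ∷ rs) → All (1 ≤_) rs →
           + flagF n i T ≡ 𝟙 (n ≡ᵇ m) * chainsDown tau rs + faceCount n i m * simplexChains m rs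
  flagF≡ T m rs ranks≡ 1≤rs = begin
    + flagF n i T
      ≡⟨ chainsAbove≡chainsUp nothing (ranks 1 T) ⟩
    chainsUp nothing (ranks 1 T)
      ≡⟨ cong (chainsUp nothing) ranks≡ ⟩
    chainsUp nothing (reverse (m ∷ rs))
      ≡⟨ chainsUp-reverse m rs ⟩
    ∑[ z ∈ cells n i ] 𝟙 (rank z ≡ᵇ m) * chainsDown z rs
      ≡⟨ ∑-cells n i (λ z → 𝟙 (rank z ≡ᵇ m) * chainsDown z rs) ⟩
    𝟙 (n ≡ᵇ m) * chainsDown tau rs
      + (∑[ G ∈ subsets ] 𝟙 (inGammaᵇ n i G) * (𝟙 (card G ≡ᵇ m) * chainsDown (face G) rs))
      ≡⟨ cong (_+_ (𝟙 (n ≡ᵇ m) * chainsDown tau rs)) (∑-cong subsets faceTerm′) ⟩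
    𝟙 (n ≡ᵇ m) * chainsDown tau rs
      + (∑[ G ∈ subsets ] 𝟙 (inGammaᵇ n i G) * 𝟙 (card G ≡ᵇ m) * simplexChains m rs)
      ≡⟨ cong (_+_ (𝟙 (n ≡ᵇ m) * chainsDown tau rs))
              (∑-*ʳ subsets (λ G → 𝟙 (inGammaᵇ n i G) * 𝟙 (card G ≡ᵇ m)) (simplexChains m rs)) ⟩
    𝟙 (n ≡ᵇ m) * chainsDown tau rs + faceCount n i m * simplexChains m rs ∎
    where
    open ≡-Reasoning
    faceTerm′ : ∀ G → 𝟙 (inGammaᵇ n i G) * (𝟙 (card G ≡ᵇ m) * chainsDown (face G) rs)
                      ≡ 𝟙 (inGammaᵇ n i G) * 𝟙 (card G ≡ᵇ m) * simplexChains m rs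
    faceTerm′ G = begin
      𝟙 (inGammaᵇ n i G) * (𝟙 (card G ≡ᵇ m) * chainsDown (face G) rs)
        ≡⟨ cong (λ e → 𝟙 (inGammaᵇ n i G) * (𝟙 e * chainsDown (face G) rs)) (sym (∧-identityʳ (card G ≡ᵇ m))) ⟩
      𝟙 (inGammaᵇ n i G) * (𝟙 ((card G ≡ᵇ m) ∧ true) * chainsDown (face G) rs)
        ≡⟨ faceTerm m rs (λ _ → true) G 1≤rs ⟩
      𝟙 (inGammaᵇ n i G) * 𝟙 ((card G ≡ᵇ m) ∧ true) * simplexChains m rs
        ≡⟨ cong (λ e → 𝟙 (inGammaᵇ n i G) * 𝟙 e * simplexChains m rs) (∧-identityʳ (card G ≡ᵇ m)) ⟩
      𝟙 (inGammaᵇ n i G) * 𝟙 (card G ≡ᵇ m) * simplexChains m rs ∎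

-- The numerical counterpart g ↦ ∑ᵢ (-1)ⁱ C(n,i) (gᵢ - gᵢ₋₁) of P^n_0

Δ : (ℕ → ℤ) → ℕ → ℤ
Δ g i = g i - previous g i

private
  +-minus-interchange : ∀ x y x′ y′ → (x + y) - (x′ + y′) ≡ (x - x′) + (y - y′)
  +-minus-interchange = solve-∀

  *-distribˡ-minus : ∀ k x x′ → k * x - k * x′ ≡ k * (x - x′)
  *-distribˡ-minus = solve-∀

Δ-+ : ∀ (g h : ℕ → ℤ) i → Δ (λ j → g j + h j) i ≡ Δ g i + Δ h i
Δ-+ g h zero    = +-minus-interchange (g 0) (h 0) (+ 0) (+ 0)
Δ-+ g h (suc j) = +-minus-interchange (g (suc j)) (h (suc j)) (g j) (h j)

Δ-*ˡ : ∀ k (g : ℕ → ℤ) i → Δ (λ j → k * g j) i ≡ k * Δ g i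
Δ-*ˡ k g zero    = trans (cong (λ x → k * g 0 - x) (sym (ℤ.*-zeroʳ k))) (*-distribˡ-minus k (g 0) (+ 0))
Δ-*ˡ k g (suc j) = *-distribˡ-minus k (g (suc j)) (g j)

P₀ : ℕ → (ℕ → ℤ) → ℤ
P₀ n g = ∑[ i ∈ upTo n ] σC n i * Δ g i

P₀-cong : ∀ n {g h : ℕ → ℤ} → (∀ i → i < n → g i ≡ h i) → P₀ n g ≡ P₀ n h
P₀-cong n {g} {h} g≡h = ∑-upTo-cong n (λ i i<n → cong (σC n i *_) (cong₂ _-_ (g≡h i i<n) (previous≡ i i<n)))
  where
  previous≡ : ∀ i → i < n → previous g i ≡ previous h i
  previous≡ zero    _   = refl
  previous≡ (suc j) j<n = g≡h j (ℕ.<-trans (ℕ.n<1+n j) j<n)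

P₀-+ : ∀ n (g h : ℕ → ℤ) → P₀ n (λ i → g i + h i) ≡ P₀ n g + P₀ n h
P₀-+ n g h = trans (∑-cong (upTo n) (λ i → trans (cong (σC n i *_) (Δ-+ g h i)) (ℤ.*-distribˡ-+ (σC n i) _ _)))
                   (∑-+ (upTo n) (λ i → σC n i * Δ g i) (λ i → σC n i * Δ h i))

P₀-*ˡ : ∀ n k (g : ℕ → ℤ) → P₀ n (λ i → k * g i) ≡ k * P₀ n g
P₀-*ˡ n k g = trans (∑-cong (upTo n) (λ i → trans (cong (σC n i *_) (Δ-*ˡ k g i)) (swap (σC n i) k (Δ g i))))
                    (∑-*ˡ (upTo n) k (λ i → σC n i * Δ g i))
  where
  swap : ∀ s k x → s * (k * x) ≡ k * (s * x)
  swap = solve-∀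

P₀-*ʳ : ∀ n k (g : ℕ → ℤ) → P₀ n (λ i → g i * k) ≡ P₀ n g * k
P₀-*ʳ n k g = trans (P₀-cong n (λ i _ → ℤ.*-comm (g i) k)) (trans (P₀-*ˡ n k g) (ℤ.*-comm k (P₀ n g)))

P₀-- : ∀ n (g h : ℕ → ℤ) → P₀ n (λ i → g i - h i) ≡ P₀ n g - P₀ n h
P₀-- n g h = begin
  P₀ n (λ i → g i - h i)               ≡⟨ P₀-+ n g (λ i → - h i) ⟩
  P₀ n g + P₀ n (λ i → - h i)          ≡⟨ cong (_+_ (P₀ n g)) (P₀-cong n (λ i _ → sym (ℤ.-1*i≡-i (h i)))) ⟩
  P₀ n g + P₀ n (λ i → -[1+ 0 ] * h i) ≡⟨ cong (_+_ (P₀ n g)) (trans (P₀-*ˡ n -[1+ 0 ] h) (ℤ.-1*i≡-i _)) ⟩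
  P₀ n g - P₀ n h                      ∎
  where open ≡-Reasoning

P₀-∑ : ∀ n (xs : List A) (h : ℕ → A → ℤ) → P₀ n (λ i → ∑ xs (h i)) ≡ ∑[ x ∈ xs ] P₀ n (λ i → h i x)
P₀-∑ n []       h =
  trans (∑-cong (upTo n) (λ i → trans (cong (σC n i *_) (Δ-zero i)) (ℤ.*-zeroʳ (σC n i)))) (∑-zero (upTo n))
  where
  Δ-zero : ∀ i → Δ (λ _ → + 0) i ≡ + 0
  Δ-zero zero    = refl
  Δ-zero (suc i) = refl
P₀-∑ n (x ∷ xs) h =
  trans (P₀-+ n (λ i → h i x) (λ i → ∑ xs (h i))) (cong (_+_ (P₀ n (λ i → h i x))) (P₀-∑ n xs h))

P₀-const : ∀ n k → 1 ≤ n → P₀ n (λ _ → k) ≡ k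
P₀-const (suc n) k _ = begin
  P₀ (suc n) (λ _ → k)
    ≡⟨ ∑-upTo-suc n (λ i → σC (suc n) i * Δ (λ _ → k) i) ⟩
  + 1 * (k - + 0) + (∑[ j ∈ upTo n ] σC (suc n) (suc j) * (k - k))
    ≡⟨ cong₂ _+_ (trans (ℤ.*-identityˡ _) (ℤ.+-identityʳ k))
                 (trans (∑-cong (upTo n) (λ j → trans (cong (σC (suc n) (suc j) *_) (ℤ.+-inverseʳ k))
                                                      (ℤ.*-zeroʳ (σC (suc n) (suc j)))))
                        (∑-zero (upTo n))) ⟩
  k + + 0
    ≡⟨ ℤ.+-identityʳ k ⟩
  k ∎
  where open ≡-Reasoning

missesUpToCount : ℕ → ℕ → ℕ → ℤ
missesUpToCount n m i = ∑[ F ∈ allSubsets (suc n) ] 𝟙 (missesUpTo i F) * 𝟙 (card F ≡ᵇ m)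

faceCount≡missesUpToCount : ∀ n i {m} → 1 ≤ m → faceCount n i m ≡ missesUpToCount n m i
faceCount≡missesUpToCount n i {m} 1≤m = ∑-cong (allSubsets (suc n)) term
  where
  term : ∀ F → 𝟙 (inGammaᵇ n i F) * 𝟙 (card F ≡ᵇ m) ≡ 𝟙 (missesUpTo i F) * 𝟙 (card F ≡ᵇ m)
  term F rewrite inGammaᵇ≡ n i F with card F ≡ᵇ m in |F|≡m
  ... | false = trans (ℤ.*-zeroʳ (𝟙 ((1 ≤ᵇ card F) ∧ missesUpTo i F))) (sym (ℤ.*-zeroʳ (𝟙 (missesUpTo i F))))
  ... | true  rewrite ≡ᵇ≡true⇒≡ {card F} |F|≡m | 1≤⇒1≤ᵇ 1≤m = refl

Δ-missesUpToCount : ∀ n m i → Δ (missesUpToCount n m) i ≡ + C↓ n m i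
Δ-missesUpToCount n m zero = begin
  missesUpToCount n m 0 - + 0
    ≡⟨ ℤ.+-identityʳ _ ⟩
  missesUpToCount n m 0
    ≡⟨ ∑-cong (allSubsets (suc n)) (λ F → cong (λ e → 𝟙 e * 𝟙 (card F ≡ᵇ m)) (missesUpTo-0 F)) ⟩
  ∑[ F ∈ allSubsets (suc n) ] 𝟙 (firstMissing 0 F) * 𝟙 (card F ≡ᵇ m)
    ≡⟨ count-firstMissing n m 0 ⟩
  + C↓ n m 0 ∎
  where open ≡-Reasoning
Δ-missesUpToCount n m (suc i) = begin
  missesUpToCount n m (suc i) - missesUpToCount n m i
    ≡⟨ sym (∑-- (allSubsets (suc n)) (λ F → 𝟙 (missesUpTo (suc i) F) * ofSize F)
                                      (λ F → 𝟙 (missesUpTo i F) * ofSize F)) ⟩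
  ∑[ F ∈ allSubsets (suc n) ] (𝟙 (missesUpTo (suc i) F) * ofSize F - 𝟙 (missesUpTo i F) * ofSize F)
    ≡⟨ ∑-cong (allSubsets (suc n)) (λ F → trans (cong (λ x → x * ofSize F - 𝟙 (missesUpTo i F) * ofSize F)
                                                      (𝟙-missesUpTo-suc i F))
                                                (cancel (𝟙 (missesUpTo i F)) (𝟙 (firstMissing (suc i) F)) (ofSize F))) ⟩
  ∑[ F ∈ allSubsets (suc n) ] 𝟙 (firstMissing (suc i) F) * ofSize F
    ≡⟨ count-firstMissing n m (suc i) ⟩
  + C↓ n m (suc i) ∎
  where
  open ≡-Reasoning
  ofSize : Vec Bool (suc n) → ℤ
  ofSize F = 𝟙 (card F ≡ᵇ m)
  cancel : ∀ p q r → (p + q) * r - p * r ≡ q * r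
  cancel = solve-∀

P₀-missesUpToCount : ∀ n {m} → 1 ≤ m → m ≤ n → P₀ n (missesUpToCount n m) ≡ - (sign n * 𝟙 (m ≡ᵇ n))
P₀-missesUpToCount n {m} 1≤m m≤n = begin
  P₀ n (missesUpToCount n m)           ≡⟨ ∑-cong (upTo n) (λ i → cong (σC n i *_) (Δ-missesUpToCount n m i)) ⟩
  ∑[ i ∈ upTo n ] σC n i * + C↓ n m i  ≡⟨ ∑σC*C↓≡-[m≡n] n 1≤m m≤n ⟩
  - (sign n * 𝟙 (m ≡ᵇ n))              ∎
  where open ≡-Reasoning

P₀-faceCount : ∀ n {m} → 1 ≤ m → m ≤ n → P₀ n (λ i → faceCount n i m) ≡ - (sign n * 𝟙 (m ≡ᵇ n))
P₀-faceCount n 1≤m m≤n =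
  trans (P₀-cong n (λ i _ → faceCount≡missesUpToCount n i 1≤m)) (P₀-missesUpToCount n 1≤m m≤n)

containsAboveCount : ℕ → ℕ → ℕ → ℤ
containsAboveCount n r i = ∑[ F ∈ allSubsets (suc n) ] 𝟙 (not (missesAbove i F)) * 𝟙 (card F ≡ᵇ r)

-- A face of ∂Γⁿᵢ misses a vertex ≤ i and a vertex > i. A vertex set of size r ≤ n misses some vertex,
-- so this is the case iff it misses a vertex ≤ i but does not contain all vertices > i.
boundaryCount≡ : ∀ n {i r} → i < suc n → 1 ≤ r → r < suc n →
                 boundaryCount n i r ≡ missesUpToCount n r i - containsAboveCount n r i
boundaryCount≡ n {i} {r} i<1+n 1≤r r<1+n =
  trans (∑-cong (allSubsets (suc n)) term) (∑-- (allSubsets (suc n)) _ _)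
  where
  inclusionExclusion : ∀ p q → (p ∨ q) ≡ true →
                       𝟙 (true ∧ p) * 𝟙 (true ∧ (p ∧ q)) ≡ 𝟙 p * + 1 - 𝟙 (not q) * + 1
  inclusionExclusion true  true  _ = refl
  inclusionExclusion true  false _ = refl
  inclusionExclusion false true  _ = refl
  term : ∀ F → 𝟙 (inGammaᵇ n i F) * 𝟙 ((card F ≡ᵇ r) ∧ inBoundaryᵇ n i F)
               ≡ 𝟙 (missesUpTo i F) * 𝟙 (card F ≡ᵇ r) - 𝟙 (not (missesAbove i F)) * 𝟙 (card F ≡ᵇ r)
  term F rewrite inGammaᵇ≡ n i F | inBoundaryᵇ≡ n i F with card F ≡ᵇ r in |F|≡r
  ... | false = trans (ℤ.*-zeroʳ (𝟙 ((1 ≤ᵇ card F) ∧ missesUpTo i F)))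
                      (sym (cong₂ _-_ (ℤ.*-zeroʳ (𝟙 (missesUpTo i F))) (ℤ.*-zeroʳ (𝟙 (not (missesAbove i F))))))
  ... | true  rewrite ≡ᵇ≡true⇒≡ {card F} |F|≡r | 1≤⇒1≤ᵇ 1≤r =
    inclusionExclusion (missesUpTo i F) (missesAbove i F) (trans (missesUpTo∨missesAbove i F i<1+n) F≠full)
    where
    F≠full : missesSome F ≡ true
    F≠full with missesSome F in none
    ... | true  = refl
    ... | false =
      contradiction (trans (sym (≡ᵇ≡true⇒≡ {card F} |F|≡r)) (missesSome≡false⇒card≡L F none)) (ℕ.<⇒≢ r<1+n)

Δ-containsAboveCount : ∀ n {r} i → 1 ≤ r → r < n → i < n → Δ (containsAboveCount n r) i ≡ + C↓ n r (n ∸ i)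
Δ-containsAboveCount n {r} zero _ r<n _ = begin
  containsAboveCount n r 0 - + 0      ≡⟨ ℤ.+-identityʳ _ ⟩
  containsAboveCount n r 0            ≡⟨ count-containsAbove (suc n) 0 r (s≤s z≤n) ⟩
  + C↓ (suc n) r n                    ≡⟨ cong +_ (trans (m<i⇒C↓≡0 (suc n) r<n) (sym (m<i⇒C↓≡0 n r<n))) ⟩
  + C↓ n r n                          ∎
  where open ≡-Reasoning
Δ-containsAboveCount n {suc r} (suc j) _ r<n j<n = begin
  containsAboveCount n (suc r) (suc j) - containsAboveCount n (suc r) j
    ≡⟨ cong₂ _-_ (count-containsAbove (suc n) (suc j) (suc r) (ℕ.m<n⇒m<1+n j<n))
                 (count-containsAbove (suc n) j (suc r) (ℕ.<-trans (ℕ.n<1+n j) (ℕ.m<n⇒m<1+n j<n))) ⟩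
  + C↓ (suc n) (suc r) (n ∸ suc j) - + C↓ (suc n) (suc r) (n ∸ j)
    ≡⟨ cong (λ k → + C↓ (suc n) (suc r) (n ∸ suc j) - + C↓ (suc n) (suc r) k) (ℕ.+-∸-assoc 1 (ℕ.<⇒≤ j<n)) ⟩
  + C↓ (suc n) (suc r) (n ∸ suc j) - + C↓ n r (n ∸ suc j)
    ≡⟨ cong (_- + C↓ n r (n ∸ suc j))
            (trans (cong +_ (C↓-pascal r (ℕ.m∸n≤m n (suc j)))) (ℤ.pos-+ (C↓ n (suc r) (n ∸ suc j)) _)) ⟩
  + C↓ n (suc r) (n ∸ suc j) + + C↓ n r (n ∸ suc j) - + C↓ n r (n ∸ suc j)
    ≡⟨ cancel (+ C↓ n (suc r) (n ∸ suc j)) (+ C↓ n r (n ∸ suc j)) ⟩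
  + C↓ n (suc r) (n ∸ suc j) ∎
  where
  open ≡-Reasoning
  cancel : ∀ x y → x + y - y ≡ x
  cancel = solve-∀

P₀-boundaryCount : ∀ n {r} → 1 ≤ r → r < n → P₀ n (λ i → boundaryCount n i r) ≡ sign n * + binomial n r
P₀-boundaryCount n {r} 1≤r r<n = begin
  P₀ n (λ i → boundaryCount n i r)
    ≡⟨ P₀-cong n (λ i i<n → boundaryCount≡ n (ℕ.m<n⇒m<1+n i<n) 1≤r (ℕ.m<n⇒m<1+n r<n)) ⟩
  P₀ n (λ i → missesUpToCount n r i - containsAboveCount n r i)
    ≡⟨ P₀-- n (missesUpToCount n r) (containsAboveCount n r) ⟩
  P₀ n (missesUpToCount n r) - P₀ n (containsAboveCount n r)
    ≡⟨ cong₂ _-_ (P₀-missesUpToCount n 1≤r (ℕ.<⇒≤ r<n))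
                 (trans (∑-upTo-cong n (λ i i<n → cong (σC n i *_) (Δ-containsAboveCount n i 1≤r r<n i<n)))
                        (∑σC*C↓-reflected n 1≤r r<n)) ⟩
  - (sign n * 𝟙 (r ≡ᵇ n)) - - (sign n * + binomial n r)
    ≡⟨ cong (λ e → - (sign n * 𝟙 e) - - (sign n * + binomial n r)) (≢⇒≡ᵇ≡false (ℕ.<⇒≢ r<n)) ⟩
  - (sign n * + 0) - - (sign n * + binomial n r)
    ≡⟨ simplify (sign n) (+ binomial n r) ⟩
  sign n * + binomial n r ∎
  where
  open ≡-Reasoning
  simplify : ∀ s x → - (s * + 0) - - (s * x) ≡ s * x
  simplify = solve-∀

-- T = ∅ and T = {n}, for T ⊆ [n] encoded as in flagF
isEmptyᵇ : List Bool → Bool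
isEmptyᵇ []          = true
isEmptyᵇ (true ∷ _)  = false
isEmptyᵇ (false ∷ T) = isEmptyᵇ T

isLastOnlyᵇ : List Bool → Bool
isLastOnlyᵇ []              = false
isLastOnlyᵇ (true ∷ [])     = true
isLastOnlyᵇ (true ∷ _ ∷ _)  = false
isLastOnlyᵇ (false ∷ T)     = isLastOnlyᵇ T

isNilᵇ : List ℕ → Bool
isNilᵇ []      = true
isNilᵇ (_ ∷ _) = false

data RankShape (k : ℕ) (T : List Bool) : Set where
  empty : ranks k T ≡ [] → isEmptyᵇ T ≡ true → isLastOnlyᵇ T ≡ false → RankShape k T
  top   : ∀ m rs → ranks k T ≡ reverse (m ∷ rs) → k ≤ m → m < k ℕ.+ length T →
          All (λ r → k ≤ r × r < m) rs → isEmptyᵇ T ≡ false →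
          isLastOnlyᵇ T ≡ ((suc m ≡ᵇ k ℕ.+ length T) ∧ isNilᵇ rs) → RankShape k T

rankShape : ∀ k T → RankShape k T
rankShape k []          = empty refl refl refl
rankShape k (false ∷ T) with rankShape (suc k) T
... | empty ranks≡ e l = empty ranks≡ e l
... | top m rs ranks≡ k<m m<k+|T| rs∈ e l =
  top m rs ranks≡ (ℕ.<⇒≤ k<m) (subst (m <_) (sym (ℕ.+-suc k (length T))) m<k+|T|)
      (All.map (λ (k<r , r<m) → ℕ.<⇒≤ k<r , r<m) rs∈) e
      (trans l (cong (λ v → (suc m ≡ᵇ v) ∧ isNilᵇ rs) (sym (ℕ.+-suc k (length T)))))
rankShape k (true ∷ T) with rankShape (suc k) T
... | empty ranks≡ _ _ = top k [] (cong (k ∷_) ranks≡) ℕ.≤-refl (ℕ.m<m+n k (s≤s z≤n)) [] refl (singleton T)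
  where
  singleton : ∀ T → isLastOnlyᵇ (true ∷ T) ≡ ((suc k ≡ᵇ k ℕ.+ length (true ∷ T)) ∧ true)
  singleton []      = sym (trans (cong (λ v → (suc k ≡ᵇ v) ∧ true) (ℕ.+-comm k 1)) (cong (_∧ true) (≡ᵇ-refl (suc k))))
  singleton (x ∷ T) = sym (cong (_∧ true) (≢⇒≡ᵇ≡false (ℕ.<⇒≢ 1+k<k+|xxT|)))
    where
    1+k<k+|xxT| : suc k < k ℕ.+ suc (suc (length T))
    1+k<k+|xxT| = subst (suc k <_) (sym (ℕ.+-suc k (suc (length T)))) (s≤s (ℕ.m<m+n k (s≤s z≤n)))
... | top m rs ranks≡ k<m m<k+|T| rs∈ _ _ =
  top m (rs ++ k ∷ []) (trans (cong (k ∷_) ranks≡) (sym (reverse-∷-∷ʳ m k rs))) (ℕ.<⇒≤ k<m)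
      (subst (m <_) (sym (ℕ.+-suc k (length T))) m<k+|T|)
      (++⁺ (All.map (λ (k<r , r<m) → ℕ.<⇒≤ k<r , r<m) rs∈) ((ℕ.≤-refl , k<m) ∷ [])) refl
      (trans (notSingleton T k<m m<k+|T|) (sym (trans (cong (_ ∧_) (isNilᵇ-∷ʳ rs k)) (∧-zeroʳ _))))
  where
  reverse-∷-∷ʳ : ∀ (m k : ℕ) rs → reverse (m ∷ (rs ++ k ∷ [])) ≡ k ∷ reverse (m ∷ rs)
  reverse-∷-∷ʳ m k rs = begin
    reverse (m ∷ (rs ++ k ∷ []))    ≡⟨ List.unfold-reverse m (rs ++ k ∷ []) ⟩
    reverse (rs ++ k ∷ []) ∷ʳ m     ≡⟨ cong (_∷ʳ m) (List.reverse-++ rs (k ∷ [])) ⟩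
    k ∷ reverse rs ∷ʳ m             ≡⟨ cong (k ∷_) (sym (List.unfold-reverse m rs)) ⟩
    k ∷ reverse (m ∷ rs)            ∎
    where open ≡-Reasoning
  isNilᵇ-∷ʳ : ∀ rs (k : ℕ) → isNilᵇ (rs ++ k ∷ []) ≡ false
  isNilᵇ-∷ʳ []       k = refl
  isNilᵇ-∷ʳ (x ∷ rs) k = refl
  notSingleton : ∀ T → suc k ≤ m → m < suc k ℕ.+ length T → isLastOnlyᵇ (true ∷ T) ≡ false
  notSingleton []      k<m m<1+k = contradiction k<m (ℕ.≤⇒≯ (ℕ.≤-pred (subst (m <_) (ℕ.+-identityʳ (suc k)) m<1+k)))
  notSingleton (x ∷ T) _   _     = refl

P₀-chainsFromTop : ∀ n m rs → 1 ≤ n → 1 ≤ m → m ≤ n → All (λ r → 1 ≤ r × r < m) rs →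
  P₀ n (λ i → 𝟙 (n ≡ᵇ m) * FacePoset.chainsDown n i tau rs + faceCount n i m * simplexChains m rs)
  ≡ 𝟙 ((m ≡ᵇ n) ∧ isNilᵇ rs) * (+ 1 - sign n)
P₀-chainsFromTop n m rs 1≤n 1≤m m≤n rs∈ = begin
  P₀ n (λ i → 𝟙 (n ≡ᵇ m) * D i rs + faceCount n i m * simplexChains m rs)
    ≡⟨ P₀-+ n (λ i → 𝟙 (n ≡ᵇ m) * D i rs) (λ i → faceCount n i m * simplexChains m rs) ⟩
  P₀ n (λ i → 𝟙 (n ≡ᵇ m) * D i rs) + P₀ n (λ i → faceCount n i m * simplexChains m rs)
    ≡⟨ cong₂ _+_ (P₀-*ˡ n (𝟙 (n ≡ᵇ m)) (λ i → D i rs)) (P₀-*ʳ n (simplexChains m rs) (λ i → faceCount n i m)) ⟩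
  𝟙 (n ≡ᵇ m) * P₀ n (λ i → D i rs) + P₀ n (λ i → faceCount n i m) * simplexChains m rs
    ≡⟨ cong (λ x → 𝟙 (n ≡ᵇ m) * P₀ n (λ i → D i rs) + x * simplexChains m rs) (P₀-faceCount n 1≤m m≤n) ⟩
  𝟙 (n ≡ᵇ m) * P₀ n (λ i → D i rs) + - (sign n * 𝟙 (m ≡ᵇ n)) * simplexChains m rs
    ≡⟨ byTop (ℕ.m≤n⇒m<n∨m≡n m≤n) rs rs∈ ⟩
  𝟙 ((m ≡ᵇ n) ∧ isNilᵇ rs) * (+ 1 - sign n) ∎
  where
  open ≡-Reasoning
  D : ℕ → List ℕ → ℤ
  D i rs = FacePoset.chainsDown n i tau rs
  byTop : m < n ⊎ m ≡ n → ∀ rs → All (λ r → 1 ≤ r × r < m) rs →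
          𝟙 (n ≡ᵇ m) * P₀ n (λ i → D i rs) + - (sign n * 𝟙 (m ≡ᵇ n)) * simplexChains m rs
          ≡ 𝟙 ((m ≡ᵇ n) ∧ isNilᵇ rs) * (+ 1 - sign n)
  byTop (inj₁ m<n) rs _ rewrite ≢⇒≡ᵇ≡false (ℕ.<⇒≢ m<n) | ≢⇒≡ᵇ≡false (ℕ.>⇒≢ m<n) =
    cong (λ x → + 0 * P₀ n (λ i → D i rs) + - x * simplexChains m rs) (ℤ.*-zeroʳ (sign n))
  byTop (inj₂ refl) [] _ rewrite ≡ᵇ-refl n =
    trans (cong (λ x → + 1 * x + - (sign n * + 1) * + 1) (P₀-const n (+ 1) 1≤n)) (oneMinus (sign n))
    where
    oneMinus : ∀ s → + 1 * + 1 + - (s * + 1) * + 1 ≡ + 1 * (+ 1 - s)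
    oneMinus = solve-∀
  byTop (inj₂ refl) (r ∷ rs′) ((1≤r , r<n) ∷ rs′∈) rewrite ≡ᵇ-refl n = begin
    + 1 * P₀ n (λ i → D i (r ∷ rs′)) + - (sign n * + 1) * (+ binomial n r * simplexChains r rs′)
      ≡⟨ cong (λ x → + 1 * x + - (sign n * + 1) * (+ binomial n r * simplexChains r rs′)) boundaryChains ⟩
    + 1 * (sign n * + binomial n r * simplexChains r rs′) + - (sign n * + 1) * (+ binomial n r * simplexChains r rs′)
      ≡⟨ cancel (sign n) (+ binomial n r) (simplexChains r rs′) ⟩
    + 0 ∎
    where
    cancel : ∀ s x y → + 1 * (s * x * y) + - (s * + 1) * (x * y) ≡ + 0
    cancel = solve-∀
    boundaryChains : P₀ n (λ i → D i (r ∷ rs′)) ≡ sign n * + binomial n r * simplexChains r rs′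
    boundaryChains = begin
      P₀ n (λ i → D i (r ∷ rs′))
        ≡⟨ P₀-cong n (λ i _ → FacePoset.chainsDown-tau n i r rs′ (≢⇒≡ᵇ≡false (ℕ.>⇒≢ r<n))
                                                     (All.map proj₁ rs′∈)) ⟩
      P₀ n (λ i → boundaryCount n i r * simplexChains r rs′)
        ≡⟨ P₀-*ʳ n (simplexChains r rs′) (λ i → boundaryCount n i r) ⟩
      P₀ n (λ i → boundaryCount n i r) * simplexChains r rs′
        ≡⟨ cong (_* simplexChains r rs′) (P₀-boundaryCount n 1≤r r<n) ⟩
      sign n * + binomial n r * simplexChains r rs′ ∎

flagP₀ : ℕ → List Bool → ℤ
flagP₀ n T = 𝟙 (isEmptyᵇ T) + 𝟙 (isLastOnlyᵇ T) * (+ 1 - sign n)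

P₀-flagF : ∀ n T → 1 ≤ n → length T ≡ n → P₀ n (λ i → + flagF n i T) ≡ flagP₀ n T
P₀-flagF n T 1≤n |T|≡n with rankShape 1 T
... | empty ranks≡ isEmpty notLastOnly = begin
  P₀ n (λ i → + flagF n i T)  ≡⟨ P₀-cong n (λ i _ → cong (λ ts → + chainsAbove n i nothing ts) ranks≡) ⟩
  P₀ n (λ _ → + 1)            ≡⟨ P₀-const n (+ 1) 1≤n ⟩
  + 1                         ≡⟨ cong₂ (λ p q → 𝟙 p + 𝟙 q * (+ 1 - sign n)) (sym isEmpty) (sym notLastOnly) ⟩
  flagP₀ n T                  ∎
  where open ≡-Reasoning
... | top m rs ranks≡ 1≤m m<1+|T| rs∈ notEmpty lastOnly rewrite |T|≡n = begin
  P₀ n (λ i → + flagF n i T)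
    ≡⟨ P₀-cong n (λ i _ → FacePoset.flagF≡ n i T m rs ranks≡ (All.map proj₁ rs∈)) ⟩
  P₀ n (λ i → 𝟙 (n ≡ᵇ m) * FacePoset.chainsDown n i tau rs + faceCount n i m * simplexChains m rs)
    ≡⟨ P₀-chainsFromTop n m rs 1≤n 1≤m (ℕ.≤-pred m<1+|T|) rs∈ ⟩
  𝟙 ((m ≡ᵇ n) ∧ isNilᵇ rs) * (+ 1 - sign n)
    ≡⟨ sym (ℤ.+-identityˡ _) ⟩
  + 0 + 𝟙 ((m ≡ᵇ n) ∧ isNilᵇ rs) * (+ 1 - sign n)
    ≡⟨ cong₂ (λ p q → 𝟙 p + 𝟙 q * (+ 1 - sign n)) (sym notEmpty) (sym lastOnly) ⟩
  flagP₀ n T ∎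
  where open ≡-Reasoning

codimSum : List Bool → (List Bool → ℤ) → ℤ
codimSum S f = ∑[ x ∈ subsetsWithCodim S ] sign (proj₂ x) * f (proj₁ x)

codimSum-false : ∀ S f → codimSum (false ∷ S) f ≡ codimSum S (λ T → f (false ∷ T))
codimSum-false S f = trans (∑-map _ (subsetsWithCodim S) _) (∑-cong (subsetsWithCodim S) (λ { (T , k) → refl }))

codimSum-true : ∀ S f → codimSum (true ∷ S) f ≡ codimSum S (λ T → f (true ∷ T)) - codimSum S (λ T → f (false ∷ T))
codimSum-true S f = begin
  codimSum (true ∷ S) f
    ≡⟨ ∑-++ (map _ (subsetsWithCodim S)) _ _ ⟩
  ∑ (map _ (subsetsWithCodim S)) _ + ∑ (map _ (subsetsWithCodim S)) _
    ≡⟨ cong₂ _+_ (trans (∑-map _ (subsetsWithCodim S) _) (∑-cong (subsetsWithCodim S) (λ { (T , k) → refl })))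
                 (trans (∑-map _ (subsetsWithCodim S) _)
                        (∑-cong (subsetsWithCodim S) (λ { (T , k) → signFlip k (f (false ∷ T)) }))) ⟩
  codimSum S (λ T → f (true ∷ T)) + (∑[ x ∈ subsetsWithCodim S ] - (sign (proj₂ x) * f (false ∷ proj₁ x)))
    ≡⟨ cong (_+_ (codimSum S (λ T → f (true ∷ T)))) (∑-neg (subsetsWithCodim S) _) ⟩
  codimSum S (λ T → f (true ∷ T)) - codimSum S (λ T → f (false ∷ T)) ∎
  where
  open ≡-Reasoning
  signFlip : ∀ k x → sign (suc k) * x ≡ - (sign k * x)
  signFlip k x = trans (cong (_* x) (sign-suc k)) (sym (ℤ.neg-distribˡ-* (sign k) x))

codimSum-cong : ∀ S {f g : List Bool → ℤ} → (∀ T → length T ≡ length S → f T ≡ g T) → codimSum S f ≡ codimSum S g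
codimSum-cong []          f≡g = cong (λ x → + 1 * x + + 0) (f≡g [] refl)
codimSum-cong (false ∷ S) {f} {g} f≡g = begin
  codimSum (false ∷ S) f                ≡⟨ codimSum-false S f ⟩
  codimSum S (λ T → f (false ∷ T))      ≡⟨ codimSum-cong S (λ T |T|≡|S| → f≡g (false ∷ T) (cong suc |T|≡|S|)) ⟩
  codimSum S (λ T → g (false ∷ T))      ≡⟨ sym (codimSum-false S g) ⟩
  codimSum (false ∷ S) g                ∎
  where open ≡-Reasoning
codimSum-cong (true ∷ S)  {f} {g} f≡g = begin
  codimSum (true ∷ S) f
    ≡⟨ codimSum-true S f ⟩
  codimSum S (λ T → f (true ∷ T)) - codimSum S (λ T → f (false ∷ T))
    ≡⟨ cong₂ _-_ (codimSum-cong S (λ T |T|≡|S| → f≡g (true ∷ T) (cong suc |T|≡|S|)))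
                 (codimSum-cong S (λ T |T|≡|S| → f≡g (false ∷ T) (cong suc |T|≡|S|))) ⟩
  codimSum S (λ T → g (true ∷ T)) - codimSum S (λ T → g (false ∷ T))
    ≡⟨ sym (codimSum-true S g) ⟩
  codimSum (true ∷ S) g ∎
  where open ≡-Reasoning

codimSum-zero : ∀ S → codimSum S (λ _ → + 0) ≡ + 0
codimSum-zero S = trans (∑-cong (subsetsWithCodim S) (λ x → ℤ.*-zeroʳ (sign (proj₂ x)))) (∑-zero (subsetsWithCodim S))

P₀-codimSum : ∀ n S (f : ℕ → List Bool → ℤ) →
              P₀ n (λ i → codimSum S (f i)) ≡ codimSum S (λ T → P₀ n (λ i → f i T))
P₀-codimSum n S f = trans (P₀-∑ n (subsetsWithCodim S) (λ i x → sign (proj₂ x) * f i (proj₁ x)))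
                          (∑-cong (subsetsWithCodim S) (λ x → P₀-*ˡ n (sign (proj₂ x)) (λ i → f i (proj₁ x))))

codimSum-isEmpty : ∀ u → codimSum (map isB u) (λ T → 𝟙 (isEmptyᵇ T)) ≡ wordSign u
codimSum-isEmpty []      = refl
codimSum-isEmpty (a ∷ u) = trans (codimSum-false (map isB u) _) (trans (codimSum-isEmpty u) (sym (ℤ.*-identityˡ (wordSign u))))
codimSum-isEmpty (b ∷ u) = begin
  codimSum (true ∷ map isB u) (λ T → 𝟙 (isEmptyᵇ T))
    ≡⟨ codimSum-true (map isB u) _ ⟩
  codimSum (map isB u) (λ _ → + 0) - codimSum (map isB u) (λ T → 𝟙 (isEmptyᵇ T))
    ≡⟨ cong₂ _-_ (codimSum-zero (map isB u)) (codimSum-isEmpty u) ⟩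
  + 0 - wordSign u
    ≡⟨ trans (ℤ.+-identityˡ _) (sym (ℤ.-1*i≡-i (wordSign u))) ⟩
  wordSign (b ∷ u) ∎
  where open ≡-Reasoning

codimSum-isEmpty+2isLastOnly : ∀ x u →
  codimSum (map isB (x ∷ u)) (λ T → 𝟙 (isEmptyᵇ T) + 𝟙 (isLastOnlyᵇ T) * + 2) ≡ wordSignInit (x ∷ u)
codimSum-isEmpty+2isLastOnly a []      = refl
codimSum-isEmpty+2isLastOnly b []      = refl
codimSum-isEmpty+2isLastOnly a (y ∷ u) =
  trans (codimSum-false (map isB (y ∷ u)) _) (trans (codimSum-isEmpty+2isLastOnly y u) (sym (ℤ.*-identityˡ _)))
codimSum-isEmpty+2isLastOnly b (y ∷ u) = begin
  codimSum (true ∷ map isB (y ∷ u)) h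
    ≡⟨ codimSum-true (map isB (y ∷ u)) h ⟩
  codimSum (map isB (y ∷ u)) (λ T → h (true ∷ T)) - codimSum (map isB (y ∷ u)) (λ T → h (false ∷ T))
    ≡⟨ cong₂ _-_ (trans (codimSum-cong (map isB (y ∷ u)) notLastOnly) (codimSum-zero (map isB (y ∷ u))))
                 (codimSum-isEmpty+2isLastOnly y u) ⟩
  + 0 - wordSignInit (y ∷ u)
    ≡⟨ trans (ℤ.+-identityˡ _) (sym (ℤ.-1*i≡-i (wordSignInit (y ∷ u)))) ⟩
  wordSignInit (b ∷ y ∷ u) ∎
  where
  open ≡-Reasoning
  h : List Bool → ℤ
  h T = 𝟙 (isEmptyᵇ T) + 𝟙 (isLastOnlyᵇ T) * + 2
  notLastOnly : ∀ T → length T ≡ length (map isB (y ∷ u)) → h (true ∷ T) ≡ + 0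
  notLastOnly (_ ∷ _) _ = refl

abCoeff-checkΦ : ∀ Φ i u → abCoeff (checkΦ Φ i) u ≡ Δ (λ j → abCoeff (Φ j) u) i
abCoeff-checkΦ Φ zero    u = sym (ℤ.+-identityʳ _)
abCoeff-checkΦ Φ (suc i) u = begin
  abCoeff (Φ (suc i) -cd Φ i) u
    ≡⟨ abCoeff-++ (Φ (suc i)) _ u ⟩
  abCoeff (Φ (suc i)) u + abCoeff (scaleCD -[1+ 0 ] (Φ i)) u
    ≡⟨ cong (_+_ (abCoeff (Φ (suc i)) u)) (trans (abCoeff-scale -[1+ 0 ] (Φ i) u) (ℤ.-1*i≡-i _)) ⟩
  abCoeff (Φ (suc i)) u - abCoeff (Φ i) u ∎
  where open ≡-Reasoning

abCoeff-P : ∀ n Φ u → abCoeff (P n 0 Φ) u ≡ P₀ n (λ i → abCoeff (Φ i) u)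
abCoeff-P n Φ u = begin
  abCoeff (P n 0 Φ) u
    ≡⟨ cong (λ is → abCoeff (concatMap term is) u) (filterB-0≤ᵇ (upTo n)) ⟩
  abCoeff (concatMap term (upTo n)) u
    ≡⟨ ∑-concatMap term (upTo n) _ ⟩
  ∑[ i ∈ upTo n ] abCoeff (term i) u
    ≡⟨ ∑-cong (upTo n) (λ i → trans (abCoeff-scale (sign i * + (n C i)) (checkΦ Φ i) u)
                                    (cong₂ _*_ (cong (λ b → sign i * + b) (C≡binomial n i)) (abCoeff-checkΦ Φ i u))) ⟩
  P₀ n (λ i → abCoeff (Φ i) u) ∎
  where
  open ≡-Reasoning
  term : ℕ → CDPoly
  term i = scaleCD (sign (i ∸ 0) * + (n C i)) (checkΦ Φ i)
  filterB-0≤ᵇ : ∀ is → filterB (0 ≤ᵇ_) is ≡ is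
  filterB-0≤ᵇ []       = refl
  filterB-0≤ᵇ (i ∷ is) = cong (i ∷_) (filterB-0≤ᵇ is)

flagH≡codimSum : ∀ n i S → flagH n i S ≡ codimSum S (λ T → + flagF n i T)
flagH≡codimSum n i S = ∑-cong (subsetsWithCodim S) (λ { (T , k) → refl })

P₀-abIndexCoeff : ∀ n u → 1 ≤ n →
                  P₀ n (λ i → abIndexCoeff n i u) ≡ 𝟙 (length u ≡ᵇ n) * codimSum (map isB u) (flagP₀ n)
P₀-abIndexCoeff n u 1≤n with length u ≡ᵇ n in |u|≡n
... | false = P₀-const n (+ 0) 1≤n
... | true  = begin
  P₀ n (λ i → flagH n i (map isB u))
    ≡⟨ P₀-cong n (λ i _ → flagH≡codimSum n i (map isB u)) ⟩
  P₀ n (λ i → codimSum (map isB u) (λ T → + flagF n i T))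
    ≡⟨ P₀-codimSum n (map isB u) (λ i T → + flagF n i T) ⟩
  codimSum (map isB u) (λ T → P₀ n (λ i → + flagF n i T))
    ≡⟨ codimSum-cong (map isB u) (λ T |T|≡|u| → P₀-flagF n T 1≤n (trans |T|≡|u| |u|≡n′)) ⟩
  codimSum (map isB u) (flagP₀ n)
    ≡⟨ sym (ℤ.*-identityˡ _) ⟩
  + 1 * codimSum (map isB u) (flagP₀ n) ∎
  where
  open ≡-Reasoning
  |u|≡n′ : length (map isB u) ≡ n
  |u|≡n′ = trans (List.length-map isB u) (≡ᵇ≡true⇒≡ |u|≡n)

abCoeff-P-cdIndex : ∀ n Φ → 1 ≤ n → (∀ i → i < n → IsCdIndexΛ n i (Φ i)) → ∀ u →
                    abCoeff (P n 0 Φ) u ≡ 𝟙 (length u ≡ᵇ n) * codimSum (map isB u) (flagP₀ n)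
abCoeff-P-cdIndex n Φ 1≤n isCdIndex u = begin
  abCoeff (P n 0 Φ) u              ≡⟨ abCoeff-P n Φ u ⟩
  P₀ n (λ i → abCoeff (Φ i) u)     ≡⟨ P₀-cong n (λ i i<n → trans (sym (coeffAB-substCD (Φ i) u)) (isCdIndex i i<n u)) ⟩
  P₀ n (λ i → abIndexCoeff n i u)  ≡⟨ P₀-abIndexCoeff n u 1≤n ⟩
  𝟙 (length u ≡ᵇ n) * codimSum (map isB u) (flagP₀ n) ∎
  where open ≡-Reasoning

sign-even : ∀ k → sign (k ℕ.* 2) ≡ + 1
sign-even zero    = refl
sign-even (suc k) = sign-even k

flagP₀-even : ∀ k T → flagP₀ (k ℕ.* 2) T ≡ 𝟙 (isEmptyᵇ T)
flagP₀-even k T = trans (cong (λ s → 𝟙 (isEmptyᵇ T) + 𝟙 (isLastOnlyᵇ T) * (+ 1 - s)) (sign-even k))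
                        (vanish (𝟙 (isEmptyᵇ T)) (𝟙 (isLastOnlyᵇ T)))
  where
  vanish : ∀ e l → e + l * (+ 1 - + 1) ≡ e
  vanish = solve-∀

flagP₀-odd : ∀ k T → flagP₀ (suc (k ℕ.* 2)) T ≡ 𝟙 (isEmptyᵇ T) + 𝟙 (isLastOnlyᵇ T) * + 2
flagP₀-odd k T = cong (λ s → 𝟙 (isEmptyᵇ T) + 𝟙 (isLastOnlyᵇ T) * (+ 1 - s))
                      (trans (sign-suc (k ℕ.* 2)) (cong -_ (sign-even k)))

P-even : ∀ {n} k Φ → n ≡ k ℕ.* 2 → 1 ≤ n → (∀ i → i < n → IsCdIndexΛ n i (Φ i)) → P n 0 Φ ≈cd powCD X k
P-even k Φ refl 1≤n isCdIndex = abCoeff-injective (P (k ℕ.* 2) 0 Φ) (powCD X k) λ u → begin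
  abCoeff (P (k ℕ.* 2) 0 Φ) u
    ≡⟨ abCoeff-P-cdIndex (k ℕ.* 2) Φ 1≤n isCdIndex u ⟩
  𝟙 (length u ≡ᵇ k ℕ.* 2) * codimSum (map isB u) (flagP₀ (k ℕ.* 2))
    ≡⟨ cong (𝟙 (length u ≡ᵇ k ℕ.* 2) *_) (codimSum-cong (map isB u) (λ T _ → flagP₀-even k T)) ⟩
  𝟙 (length u ≡ᵇ k ℕ.* 2) * codimSum (map isB u) (λ T → 𝟙 (isEmptyᵇ T))
    ≡⟨ cong (𝟙 (length u ≡ᵇ k ℕ.* 2) *_) (codimSum-isEmpty u) ⟩
  𝟙 (length u ≡ᵇ k ℕ.* 2) * wordSign u
    ≡⟨ sym (abCoeff-X^k k u) ⟩
  abCoeff (powCD X k) u ∎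
  where open ≡-Reasoning

P-odd : ∀ {n} k Φ → n ≡ suc (k ℕ.* 2) → (∀ i → i < n → IsCdIndexΛ n i (Φ i)) → P n 0 Φ ≈cd (powCD X k *cd cP)
P-odd k Φ refl isCdIndex = abCoeff-injective (P (suc (k ℕ.* 2)) 0 Φ) (powCD X k *cd cP) λ u → begin
  abCoeff (P (suc (k ℕ.* 2)) 0 Φ) u
    ≡⟨ abCoeff-P-cdIndex (suc (k ℕ.* 2)) Φ (s≤s z≤n) isCdIndex u ⟩
  𝟙 (length u ≡ᵇ suc (k ℕ.* 2)) * codimSum (map isB u) (flagP₀ (suc (k ℕ.* 2)))
    ≡⟨ cong (𝟙 (length u ≡ᵇ suc (k ℕ.* 2)) *_) (codimSum-cong (map isB u) (λ T _ → flagP₀-odd k T)) ⟩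
  𝟙 (length u ≡ᵇ suc (k ℕ.* 2)) * codimSum (map isB u) (λ T → 𝟙 (isEmptyᵇ T) + 𝟙 (isLastOnlyᵇ T) * + 2)
    ≡⟨ nonempty u ⟩
  𝟙 (length u ≡ᵇ suc (k ℕ.* 2)) * wordSignInit u
    ≡⟨ sym (abCoeff-X^k*c k u) ⟩
  abCoeff (powCD X k *cd cP) u ∎
  where
  open ≡-Reasoning
  nonempty : ∀ u →
    𝟙 (length u ≡ᵇ suc (k ℕ.* 2)) * codimSum (map isB u) (λ T → 𝟙 (isEmptyᵇ T) + 𝟙 (isLastOnlyᵇ T) * + 2)
    ≡ 𝟙 (length u ≡ᵇ suc (k ℕ.* 2)) * wordSignInit u
  nonempty []      = refl
  nonempty (x ∷ u) = cong (𝟙 (length (x ∷ u) ≡ᵇ suc (k ℕ.* 2)) *_) (codimSum-isEmpty+2isLastOnly x u)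

lemma5p3 : (n : ℕ) → 3 ≤ n → (Φ : ℕ → CDPoly) → (∀ i → i < n → IsCdIndexΛ n i (Φ i)) →
    (n % 2 ≡ 0 → P n 0 Φ ≈cd powCD ((cP *cd cP) -cd scaleCD (Data.Integer.+ 2) dP) (n / 2))
    × (n % 2 ≡ 1 → P n 0 Φ ≈cd (powCD ((cP *cd cP) -cd scaleCD (Data.Integer.+ 2) dP) ((n ∸ 1) / 2) *cd cP))
lemma5p3 n 3≤n Φ isCdIndex = even , odd
  where
  n≡ : n ≡ n % 2 ℕ.+ n / 2 ℕ.* 2
  n≡ = m≡m%n+[m/n]*n n 2
  even : n % 2 ≡ 0 → P n 0 Φ ≈cd powCD X (n / 2)
  even n%2≡0 = P-even (n / 2) Φ (trans n≡ (cong (ℕ._+ n / 2 ℕ.* 2) n%2≡0)) (ℕ.≤-trans (s≤s z≤n) 3≤n) isCdIndex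
  odd : n % 2 ≡ 1 → P n 0 Φ ≈cd (powCD X ((n ∸ 1) / 2) *cd cP)
  odd n%2≡1 = subst (λ k → P n 0 Φ ≈cd (powCD X k *cd cP)) (sym half) (P-odd (n / 2) Φ n≡1+2k isCdIndex)
    where
    n≡1+2k : n ≡ suc (n / 2 ℕ.* 2)
    n≡1+2k = trans n≡ (cong (ℕ._+ n / 2 ℕ.* 2) n%2≡1)
    half : (n ∸ 1) / 2 ≡ n / 2
    half = trans (cong (λ m → (m ∸ 1) / 2) n≡1+2k) (m*n/n≡m (n / 2) 2)
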